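{- A dessin $\mathcal D\in GP(n,p,c)$ is invariant (up to isomorphism) under all twelve operations in $\Omega^*$ if and only if $n=3$, $p\equiv2\pmod3$ and $c=1$.
   Context: A regular dessin is determined up to isomorphism by a triple $(G;x,y)$ with $G$ a finite group generated by $x,y$; $(G;x,y)$ and $(G';x',y')$ give isomorphic dessins iff some isomorphism $G\to G'$ sends $x\mapsto x'$, $y\mapsto y'$. Put $z=(xy)^{ -1}$. The group $\Omega\cong S_3$ consists of the identity and the operations $\mathcal D^{01}=(G;y,x)$, $\mathcal D^{12}=(G;x,z)$, $\mathcal D^{02}=(G;z,y)$, $\mathcal D^{012}=(G;y,z)$, $\mathcal D^{210}=(G;z,x)$. The operation $H_{ -1}$ sends $(G;x,y)$ to its mirror image $(G;x^{ -1},y^{ -1})$; it commutes with $\Omega$, and $\Omega^*=\langle\Omega,H_{ -1}\rangle\cong S_3\times C_2$ consists of the twelve operations $\omega$ and $H_{ -1}\circ\omega$, $\omega\in\Omega$. Generalised Paley dessins: let $p$ be prime, $d\ge1$, $q=p^d$. Let ${\rm AGL}_1(q)$ be the group of maps $t\mapsto at+b$ of ${\mathbb F}_q$ ($a\ne0$), $T=\{t\mapsto t+b\}$. For a subgroup $S\le{\mathbb F}_q^*$ of order $n$ (identified with $\{t\mapsto at:a\in S\}$), $G_S=T\rtimes S$, where either $n=d=1$, or $n>1$ and $p$ has multiplicative order $d$ mod $n$. For $x$ a generator of $S$ and $y\in G_S\setminus S$, the regular dessin $(G_S;x,y)$ is a generalised Paley dessin with valency $n$ and characteristic $p$; its colour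 constant is the unique $c\in{\mathbb Z}_n$ with $y\in Tx^c$. $GP(n,p,c)$ is the set of isomorphism classes of these with colour constant $c$. -}

module Defs where

open import Level using (0ℓ)
open import Data.Nat using (ℕ; zero; suc; _≤_; _<_; _∸_; _^_)
import Data.Nat as ℕ
open import Data.Nat.Divisibility using (_∣_)
open import Data.Fin using (Fin)
open import Data.Product using (Σ; ∃; _×_; _,_; proj₁; proj₂)
open import Data.Sum using (_⊎_)
open import Relation.Nullary using (¬_)
open import Relation.Binary.PropositionalEquality using (_≡_; _≢_)
open import Algebra.Structures using (IsCommutativeRing)
open import Function.Bundles using (_↔_)

record FiniteField (q : ℕ) : Set₁ where
  infixl 7 _*_
  infixl 6 _+_
  field
    Carrier : Set
    _+_ _*_ : Carrier → Carrier → Carrier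
    -_      : Carrier → Carrier
    0# 1#   : Carrier
    isCommutativeRing : IsCommutativeRing _≡_ _+_ _*_ -_ 0# 1#
    0≢1     : 0# ≢ 1#
    inverse : ∀ a → a ≢ 0# → ∃ λ b → a * b ≡ 1#
    card    : Carrier ↔ Fin q

  _^ᶠ_ : Carrier → ℕ → Carrier
  a ^ᶠ zero  = 1#
  a ^ᶠ suc k = a * (a ^ᶠ k)

MultOrder : (p n d : ℕ) → Set
MultOrder p n d =
  1 ≤ d × n ∣ (p ^ d ∸ 1) × (∀ e → 1 ≤ e → e < d → ¬ (n ∣ (p ^ e ∸ 1)))

AdmissibleValency : (p d n : ℕ) → Set
AdmissibleValency p d n = (n ≡ 1 × d ≡ 1) ⊎ (1 < n × MultOrder p n d)

module _ {q : ℕ} (F : FiniteField q) where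
  open FiniteField F

  HasOrder : Carrier → ℕ → Set
  HasOrder ξ n = 1 ≤ n × ξ ^ᶠ n ≡ 1# × (∀ k → 1 ≤ k → k < n → ξ ^ᶠ k ≢ 1#)

-- The group G_S = T ⋊ S ≤ AGL_1(q), where S = ⟨ξ⟩ ≤ F^* has order n.
-- An element (k , b) stands for the affine map  t ↦ ξ^k t + b.
-- Two elements are equal iff they are the same map, i.e. ξ^k ≡ ξ^k'
-- and b ≡ b'.  Multiplication is composition of maps:
-- (g · h)(t) = g (h t).

module Paley {q : ℕ} (F : FiniteField q) (n : ℕ) (ξ : FiniteField.Carrier F) where
  open FiniteField F

  G : Set
  G = ℕ × Carrier

  infix 4 _≈_
  _≈_ : G → G → Set
  (k , b) ≈ (k' , b') = ξ ^ᶠ k ≡ ξ ^ᶠ k' × b ≡ b'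

  infixl 7 _·_
  _·_ : G → G → G
  (k , b) · (k' , b') = (k ℕ.+ k' , ξ ^ᶠ k * b' + b)

  e : G
  e = (0 , 0#)

  -- inverse of t ↦ a t + b is t ↦ a⁻¹ t − a⁻¹ b, with a⁻¹ = ξ^(k(n−1))
  -- when a = ξ^k (as ξ^n = 1)
  inv : G → G
  inv (k , b) = (k ℕ.* (n ∸ 1) , - (ξ ^ᶠ (k ℕ.* (n ∸ 1)) * b))

  pow : G → ℕ → G
  pow g zero    = e
  pow g (suc c) = g · pow g c

  τ : Carrier → G
  τ b = (0 , b)

  x : G
  x = (1 , 0#)

  InS : G → Set
  InS g = ∃ λ k → g ≈ (k , 0#)

  ColourConstant : G → ℕ → Set
  ColourConstant y c = ∃ λ b → y ≈ τ b · pow x c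

  Dessin : Set
  Dessin = G × G

  record Iso (D₁ D₂ : Dessin) : Set where
    field
      φ        : G → G
      φ-cong   : ∀ g h → g ≈ h → φ g ≈ φ h
      φ-hom    : ∀ g h → φ (g · h) ≈ φ g · φ h
      φ-inj    : ∀ g h → φ g ≈ φ h → g ≈ h
      φ-surj   : ∀ h → ∃ λ g → φ g ≈ h
      φ-x      : φ (proj₁ D₁) ≈ proj₁ D₂
      φ-y      : φ (proj₂ D₁) ≈ proj₂ D₂

  -- The group Ω ≅ S₃ of operations, with z = (xy)⁻¹.
  data Ω : Set where
    idΩ D01 D12 D02 D012 D210 : Ω

  applyΩ : Ω → Dessin → Dessin
  applyΩ idΩ  (u , v) = (u , v)
  applyΩ D01  (u , v) = (v , u)
  applyΩ D12  (u , v) = (u , inv (u · v))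
  applyΩ D02  (u , v) = (inv (u · v) , v)
  applyΩ D012 (u , v) = (v , inv (u · v))
  applyΩ D210 (u , v) = (inv (u · v) , u)

  H-1 : Dessin → Dessin
  H-1 (u , v) = (inv u , inv v)

  data Ω* : Set where
    plain  : Ω → Ω*
    mirror : Ω → Ω*

  applyΩ* : Ω* → Dessin → Dessin
  applyΩ* (plain ω)  D = applyΩ ω D
  applyΩ* (mirror ω) D = H-1 (applyΩ ω D)

  FullyInvariant : Dessin → Set
  FullyInvariant D = ∀ (ω : Ω*) → Iso D (applyΩ* ω D)

-- Automorphisms of G_S = T ⋊ S preserve T, the set of elements g with g^q = 1, so an automorphism
-- sending x to u sends every element of T x^c to one whose linear part is that of u to the power c.
-- Invariance under D⁰¹ and D⁰¹² therefore forces ξ = η^c, η = ξ^c and ξ²η = 1 for the linear part η of y,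
-- whence ξ³ = 1, n = 3 and c = 1. Since 3 ∣ q − 1, p ≢ 0 (mod 3); if p ≡ 1 (mod 3) the order condition
-- gives q = p, and over the prime field every automorphism fixes the linear part of x, so x cannot be
-- sent to x⁻¹ and mirror invariance fails.
-- Conversely, for n = 3 and c = 1 the three elements x, y and z = (xy)⁻¹ lie in the coset xT with
-- distinct translation parts, and conjugation by affine maps of 𝔽_q moves any such pair to any other.
-- For the mirror images one first applies t ↦ t^p, which maps xT to x²T = x⁻¹T when p ≡ 2 (mod 3).

module Submission where

open import Defs
open import Data.Nat using (ℕ; _≤_; _<_; _^_; _%_)
open import Data.Nat.Primality using (Prime)
open import Data.Product using (_×_; _,_; proj₁; proj₂)
open import Relation.Nullary using (¬_)
open import Relation.Binary.PropositionalEquality using (_≡_)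
open import Function.Bundles using (_⇔_)

-- Arithmetic

module PrimeBinomial where
  open import Data.Nat
  open import Data.Nat.Properties
  open import Data.Nat.Divisibility
  open import Data.Nat.Primality
  open import Data.Nat.Combinatorics
  open import Data.Nat.DivMod using (m/n*n≡m)
  open import Data.Sum using (inj₁; inj₂)
  open import Relation.Binary.PropositionalEquality
  open import Data.Empty using (⊥-elim)
  open import Data.Product using (∃)

  prime⇒2+ : ∀ {p} → Prime p → ∃ λ m → p ≡ 2 + m
  prime⇒2+ {suc (suc m)} _ = m , refl

  prime∤! : ∀ {p} → Prime p → ∀ m → m < p → p ∤ m !
  prime∤! pp zero    _   p∣1  = ¬prime[1] (subst Prime (∣1⇒≡1 p∣1) pp)
  prime∤! pp (suc m) m<p p∣m! with euclidsLemma (suc m) (m !) pp p∣m!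
  ... | inj₁ p∣1+m = <⇒≱ m<p (∣⇒≤ p∣1+m)
  ... | inj₂ p∣m!  = prime∤! pp m (<-trans (n<1+n m) m<p) p∣m!

  prime∣pCk : ∀ {p k} → Prime p → 0 < k → k < p → p ∣ p C k
  prime∣pCk {p@(suc p-1)} {k} pp 0<k k<p
    with euclidsLemma (p C k) (k ! * (p ∸ k) !) pp p∣pCk*k!*[p-k]!
    where
    instance _ = k !* (p ∸ k) !≢0
    p∣pCk*k!*[p-k]! : p ∣ (p C k) * (k ! * (p ∸ k) !)
    p∣pCk*k!*[p-k]! = subst (p ∣_) (sym pCk*k!*[p-k]!≡p!) (m∣m*n (p-1 !))
      where
      pCk*k!*[p-k]!≡p! : (p C k) * (k ! * (p ∸ k) !) ≡ p !
      pCk*k!*[p-k]!≡p! = trans (cong (_* (k ! * (p ∸ k) !)) (nCk≡n!/k![n-k]! (<⇒≤ k<p)))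
                              (m/n*n≡m (k![n∸k]!∣n! (<⇒≤ k<p)))
  ... | inj₁ p∣pCk = p∣pCk
  ... | inj₂ p∣k!*[p-k]! with euclidsLemma (k !) ((p ∸ k) !) pp p∣k!*[p-k]!
  ...   | inj₁ p∣k!      = ⊥-elim (prime∤! pp k k<p p∣k!)
  ...   | inj₂ p∣[p-k]!  = ⊥-elim (prime∤! pp (p ∸ k) (∸-monoʳ-< 0<k (<⇒≤ k<p)) p∣[p-k]!)

module Arithmetic where
  open import Data.Nat
  open import Data.Nat.Properties
  open import Data.Nat.Divisibility
  open import Data.Nat.DivMod using (_/_; m≡m%n+[m/n]*n)
  open import Data.Sum using (inj₁; inj₂)
  open import Relation.Binary.PropositionalEquality
  open import Relation.Nullary using (contradiction)
  open import Data.Nat.Solver using (module +-*-Solver)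

  <3∧≢0∧≢2⇒≡1 : ∀ {m} → m < 3 → m ≢ 0 → m ≢ 2 → m ≡ 1
  <3∧≢0∧≢2⇒≡1 {0} _ m≢0 _ = contradiction refl m≢0
  <3∧≢0∧≢2⇒≡1 {1} _ _   _ = refl
  <3∧≢0∧≢2⇒≡1 {2} _ _ m≢2 = contradiction refl m≢2
  <3∧≢0∧≢2⇒≡1 {suc (suc (suc _))} (s≤s (s≤s (s≤s ())))

  <3∧≢0∧≢1⇒≡2 : ∀ {m} → m < 3 → m ≢ 0 → m ≢ 1 → m ≡ 2
  <3∧≢0∧≢1⇒≡2 {0} _ m≢0 _ = contradiction refl m≢0
  <3∧≢0∧≢1⇒≡2 {1} _ _ m≢1 = contradiction refl m≢1
  <3∧≢0∧≢1⇒≡2 {2} _ _ _   = refl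
  <3∧≢0∧≢1⇒≡2 {suc (suc (suc _))} (s≤s (s≤s (s≤s ())))

  ∣pᵈ∸1∧∣p⇒≡1 : ∀ {m p d} .{{_ : NonZero p}} → 1 ≤ d → m ∣ p ^ d ∸ 1 → m ∣ p → m ≡ 1
  ∣pᵈ∸1∧∣p⇒≡1 {m} {p} {suc d} _ m∣pᵈ-1 m∣p = ∣1⇒≡1 (∣m+n∣m⇒∣n m∣pᵈ-1+1 m∣pᵈ-1)
    where
    m∣pᵈ-1+1 : m ∣ (p ^ suc d ∸ 1) + 1
    m∣pᵈ-1+1 = subst (m ∣_) (sym (m∸n+n≡m (m^n>0 p (suc d)))) (∣-trans m∣p (m∣m*n (p ^ d)))

  %≡1⇒∣∸1 : ∀ m n .{{_ : NonZero n}} → m % n ≡ 1 → n ∣ m ∸ 1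
  %≡1⇒∣∸1 m n m%n≡1 = divides (m / n) (begin
    m ∸ 1                    ≡⟨ cong (_∸ 1) (m≡m%n+[m/n]*n m n) ⟩
    m % n + m / n * n ∸ 1    ≡⟨ cong (λ r → r + m / n * n ∸ 1) m%n≡1 ⟩
    m / n * n                ∎)
    where open ≡-Reasoning

  %3≡2⇒≡2+[/3]*3 : ∀ m → m % 3 ≡ 2 → m ≡ 2 + m / 3 * 3
  %3≡2⇒≡2+[/3]*3 m m%3≡2 = trans (m≡m%n+[m/n]*n m 3) (cong (_+ m / 3 * 3) m%3≡2)

  %3≡2⇒*2≡1+[1+[/3]*2]*3 : ∀ m → m % 3 ≡ 2 → m * 2 ≡ 1 + (1 + m / 3 * 2) * 3
  %3≡2⇒*2≡1+[1+[/3]*2]*3 m m%3≡2 = trans (cong (_* 2) (%3≡2⇒≡2+[/3]*3 m m%3≡2)) (reassociate (m / 3))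
    where
    open +-*-Solver
    reassociate : ∀ k → (2 + k * 3) * 2 ≡ 1 + (1 + k * 2) * 3
    reassociate = solve 1 (λ k → (con 2 :+ k :* con 3) :* con 2 := con 1 :+ (con 1 :+ k :* con 2) :* con 3) refl

  multOrder-minimal : ∀ {p n d e} → MultOrder p n d → 1 ≤ e → n ∣ p ^ e ∸ 1 → d ≤ e
  multOrder-minimal {d = d} {e} (_ , _ , minimal) 1≤e n∣pᵉ-1 with ≤-<-connex d e
  ... | inj₁ d≤e = d≤e
  ... | inj₂ e<d = contradiction n∣pᵉ-1 (minimal e 1≤e e<d)

-- Finite fields

module FieldProperties {q : ℕ} (F : FiniteField q) where
  open FiniteField F public
  open import Level using (0ℓ)
  open import Algebra.Bundles using (CommutativeRing)
  open import Algebra.Solver.Ring.AlmostCommutativeRing using (fromCommutativeRing; _-Raw-AlmostCommutative⟶_)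
  open import Data.Empty using (⊥-elim)
  open import Data.Fin using (Fin; toℕ; punchOut)
  import Data.Fin.Permutation as Perm
  import Data.Fin.Properties as Fin
  open import Data.Integer as ℤ using (ℤ)
  import Data.Integer.Properties as ℤ
  import Data.Maybe
  open import Data.Nat as ℕ using (zero; suc)
  open import Data.Nat.Divisibility using (divides)
  import Data.Nat.Properties as ℕP
  open import Data.Product using (∃)
  open import Data.Sign as Sign using (Sign)
  open import Function.Bundles using (Inverse)
  open import Function.Properties.Inverse using (↔⇒↣)
  open import Relation.Binary.Definitions using (tri<; tri≈; tri>)
  open import Relation.Binary.PropositionalEquality
  open import Relation.Nullary using (Dec; yes; no)
  open import Relation.Nullary.Decidable using (dec⇒maybe; via-injection)
  open ≡-Reasoning

  commutativeRing : CommutativeRing 0ℓ 0ℓ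
  commutativeRing = record { isCommutativeRing = isCommutativeRing }

  open CommutativeRing commutativeRing public
    using (ring; +-comm; *-assoc; *-comm; +-identityˡ; +-identityʳ; *-identityˡ; *-identityʳ;
           zeroˡ; zeroʳ; -‿inverseʳ; _-_)
  open import Algebra.Properties.Ring ring public
    using (-0#≈0#; -‿involutive; -‿injective; +-cancelˡ; +-cancelʳ; +-inverseʳ-unique; -‿distribˡ-*; -‿+-comm;
           x∙y⁻¹≈ε⇒x≈y; x≈y⇒x∙y⁻¹≈ε)
  open import Algebra.Properties.CommutativeSemigroup (CommutativeRing.+-commutativeSemigroup commutativeRing)
    using () renaming (interchange to +-interchange)
  open import Algebra.Properties.CommutativeSemigroup (CommutativeRing.*-commutativeSemigroup commutativeRing)
    using () renaming (interchange to *-interchange)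
  open import Algebra.Properties.Semiring.Mult.TCOptimised (CommutativeRing.semiring commutativeRing)
    using (1+×; ×-homo-+; ×1-homo-*; ×ᵤ≈×) renaming (_×_ to _×′_)
  open import Algebra.Properties.Semiring.Mult (CommutativeRing.semiring commutativeRing)
    using (×-assoc-*) renaming (_×_ to _×ᵤ_)
  open import Algebra.Properties.CommutativeMonoid.Sum (CommutativeRing.+-commutativeMonoid commutativeRing)
    using (sum; sum-replicate; sum-replicate-zero; ∑-distrib-+; sum-cong-≗; sum-permute; sum-init-last)

  -- The optimised multiple `_×′_` makes `fromℕ 1` reduce to `1#`, as `ℤ⟶F` below requires.
  fromℕ : ℕ → Carrier
  fromℕ n = n ×′ 1#

  fromℕ-suc : ∀ n → fromℕ (suc n) ≡ 1# + fromℕ n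
  fromℕ-suc n = 1+× n 1#

  fromℕ-+ : ∀ m n → fromℕ (m ℕ.+ n) ≡ fromℕ m + fromℕ n
  fromℕ-+ = ×-homo-+ 1#

  fromℕ-* : ∀ m n → fromℕ (m ℕ.* n) ≡ fromℕ m * fromℕ n
  fromℕ-* = ×1-homo-*

  fromSign : Sign → Carrier
  fromSign Sign.+ = 1#
  fromSign Sign.- = - 1#

  fromℤ : ℤ → Carrier
  fromℤ (ℤ.+ n)    = fromℕ n
  fromℤ ℤ.-[1+ n ] = - fromℕ (suc n)

  fromℤ-⊖ : ∀ m n → fromℤ (m ℤ.⊖ n) ≡ fromℕ m - fromℕ n
  fromℤ-⊖ m zero = begin
    fromℤ (m ℤ.⊖ 0)  ≡⟨ cong fromℤ (ℤ.⊖-≥ {m} ℕ.z≤n) ⟩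
    fromℕ m          ≡⟨ sym (+-identityʳ _) ⟩
    fromℕ m + 0#     ≡⟨ cong (fromℕ m +_) (sym -0#≈0#) ⟩
    fromℕ m - 0#     ∎
  fromℤ-⊖ zero (suc n) = sym (+-identityˡ _)
  fromℤ-⊖ (suc m) (suc n) = begin
    fromℤ (suc m ℤ.⊖ suc n)             ≡⟨ cong fromℤ (ℤ.[1+m]⊖[1+n]≡m⊖n m n) ⟩
    fromℤ (m ℤ.⊖ n)                     ≡⟨ fromℤ-⊖ m n ⟩
    fromℕ m - fromℕ n                   ≡⟨ sym ([1+a]-[1+b]≡a-b (fromℕ m) (fromℕ n)) ⟩
    (1# + fromℕ m) - (1# + fromℕ n)     ≡⟨ sym (cong₂ _-_ (fromℕ-suc m) (fromℕ-suc n)) ⟩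
    fromℕ (suc m) - fromℕ (suc n)       ∎
    where
    [1+a]-[1+b]≡a-b : ∀ a b → (1# + a) - (1# + b) ≡ a - b
    [1+a]-[1+b]≡a-b a b = begin
      (1# + a) + - (1# + b)     ≡⟨ cong ((1# + a) +_) (sym (-‿+-comm 1# b)) ⟩
      (1# + a) + (- 1# + - b)   ≡⟨ +-interchange 1# a (- 1#) (- b) ⟩
      (1# + - 1#) + (a + - b)   ≡⟨ cong (_+ (a + - b)) (-‿inverseʳ 1#) ⟩
      0# + (a + - b)            ≡⟨ +-identityˡ _ ⟩
      a - b                     ∎

  fromℤ-+ : ∀ i j → fromℤ (i ℤ.+ j) ≡ fromℤ i + fromℤ j
  fromℤ-+ (ℤ.+ m)    (ℤ.+ n)    = fromℕ-+ m n
  fromℤ-+ (ℤ.+ m)    ℤ.-[1+ n ] = fromℤ-⊖ m (suc n)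
  fromℤ-+ ℤ.-[1+ m ] (ℤ.+ n)    = trans (fromℤ-⊖ n (suc m)) (+-comm _ _)
  fromℤ-+ ℤ.-[1+ m ] ℤ.-[1+ n ] = begin
    - fromℕ (suc (suc (m ℕ.+ n)))        ≡⟨ cong (λ k → - fromℕ (suc k)) (sym (+-suc m n)) ⟩
    - fromℕ (suc m ℕ.+ suc n)            ≡⟨ cong -_ (fromℕ-+ (suc m) (suc n)) ⟩
    - (fromℕ (suc m) + fromℕ (suc n))    ≡⟨ sym (-‿+-comm _ _) ⟩
    - fromℕ (suc m) + - fromℕ (suc n)    ∎
    where open import Data.Nat.Properties using (+-suc)

  fromℤ-neg : ∀ i → fromℤ (ℤ.- i) ≡ - fromℤ i
  fromℤ-neg (ℤ.+ zero)  = sym -0#≈0#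
  fromℤ-neg (ℤ.+ suc n) = refl
  fromℤ-neg ℤ.-[1+ n ]  = sym (-‿involutive _)

  -1*x≡-x : ∀ x → - 1# * x ≡ - x
  -1*x≡-x x = trans (sym (-‿distribˡ-* 1# x)) (cong -_ (*-identityˡ x))

  fromSign-* : ∀ s t → fromSign (s Sign.* t) ≡ fromSign s * fromSign t
  fromSign-* Sign.+ t      = sym (*-identityˡ _)
  fromSign-* Sign.- Sign.+ = sym (*-identityʳ _)
  fromSign-* Sign.- Sign.- = sym (trans (-1*x≡-x (- 1#)) (-‿involutive 1#))

  fromℤ-◃ : ∀ s n → fromℤ (s ℤ.◃ n) ≡ fromSign s * fromℕ n
  fromℤ-◃ s      zero    = sym (zeroʳ _)
  fromℤ-◃ Sign.+ (suc n) = sym (*-identityˡ _)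
  fromℤ-◃ Sign.- (suc n) = sym (-1*x≡-x _)

  fromℤ-signAbs : ∀ i → fromℤ i ≡ fromSign (ℤ.sign i) * fromℕ ℤ.∣ i ∣
  fromℤ-signAbs i = trans (cong fromℤ (sym (ℤ.◃-inverse i))) (fromℤ-◃ (ℤ.sign i) ℤ.∣ i ∣)

  fromℤ-* : ∀ i j → fromℤ (i ℤ.* j) ≡ fromℤ i * fromℤ j
  fromℤ-* i j = begin
    fromℤ (i ℤ.* j)
      ≡⟨ fromℤ-◃ (ℤ.sign i Sign.* ℤ.sign j) (ℤ.∣ i ∣ ℕ.* ℤ.∣ j ∣) ⟩
    fromSign (ℤ.sign i Sign.* ℤ.sign j) * fromℕ (ℤ.∣ i ∣ ℕ.* ℤ.∣ j ∣)
      ≡⟨ cong₂ _*_ (fromSign-* (ℤ.sign i) (ℤ.sign j)) (fromℕ-* ℤ.∣ i ∣ ℤ.∣ j ∣) ⟩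
    (fromSign (ℤ.sign i) * fromSign (ℤ.sign j)) * (fromℕ ℤ.∣ i ∣ * fromℕ ℤ.∣ j ∣)
      ≡⟨ *-interchange _ _ _ _ ⟩
    (fromSign (ℤ.sign i) * fromℕ ℤ.∣ i ∣) * (fromSign (ℤ.sign j) * fromℕ ℤ.∣ j ∣)
      ≡⟨ sym (cong₂ _*_ (fromℤ-signAbs i) (fromℤ-signAbs j)) ⟩
    fromℤ i * fromℤ j ∎

  -- The solver needs coefficients whose equality computes, so it runs over ℤ, which maps into any ring.
  ℤ⟶F : CommutativeRing.rawRing ℤ.+-*-commutativeRing -Raw-AlmostCommutative⟶ fromCommutativeRing commutativeRing
  ℤ⟶F = record
    { ⟦_⟧ = fromℤ ; +-homo = fromℤ-+ ; *-homo = fromℤ-* ; -‿homo = fromℤ-neg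
    ; 0-homo = refl ; 1-homo = refl }

  open import Algebra.Solver.Ring (CommutativeRing.rawRing ℤ.+-*-commutativeRing)
    (fromCommutativeRing commutativeRing) ℤ⟶F (λ i j → Data.Maybe.map (cong fromℤ) (dec⇒maybe (i ℤ.≟ j)))
    public using (solve; _:=_; _:+_; _:*_; _:-_; :-_; con; Polynomial)

  :0 :1 : ∀ {m} → Polynomial m
  :0 = con (ℤ.+ 0)
  :1 = con (ℤ.+ 1)

  _≟_ : (a b : Carrier) → Dec (a ≡ b)
  _≟_ = via-injection (↔⇒↣ card) Fin._≟_

  *-nonzero : ∀ {a b} → a ≢ 0# → b ≢ 0# → a * b ≢ 0#
  *-nonzero {a} {b} a≢0 b≢0 ab≡0 with inverse a a≢0
  ... | a⁻¹ , aa⁻¹≡1 = b≢0 (begin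
    b              ≡⟨ sym (*-identityˡ b) ⟩
    1# * b         ≡⟨ cong (_* b) (sym aa⁻¹≡1) ⟩
    (a * a⁻¹) * b  ≡⟨ solve 3 (λ a a' b → (a :* a') :* b := a' :* (a :* b)) refl a a⁻¹ b ⟩
    a⁻¹ * (a * b)  ≡⟨ cong (a⁻¹ *_) ab≡0 ⟩
    a⁻¹ * 0#       ≡⟨ zeroʳ a⁻¹ ⟩
    0#             ∎)

  *-zero-divisor : ∀ {a b} → a * b ≡ 0# → b ≢ 0# → a ≡ 0#
  *-zero-divisor {a} ab≡0 b≢0 with a ≟ 0#
  ... | yes a≡0 = a≡0
  ... | no  a≢0 = ⊥-elim (*-nonzero a≢0 b≢0 ab≡0)

  *-cancelˡ : ∀ {a} b c → a ≢ 0# → a * b ≡ a * c → b ≡ c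
  *-cancelˡ {a} b c a≢0 ab≡ac with (b - c) ≟ 0#
  ... | yes b-c≡0 = x∙y⁻¹≈ε⇒x≈y b c b-c≡0
  ... | no  b-c≢0 = ⊥-elim (*-nonzero a≢0 b-c≢0 (begin
    a * (b - c)      ≡⟨ solve 3 (λ a b c → a :* (b :- c) := a :* b :- a :* c) refl a b c ⟩
    a * b - a * c    ≡⟨ x≈y⇒x∙y⁻¹≈ε ab≡ac ⟩
    0#               ∎))

  ^-+ : ∀ a m n → a ^ᶠ (m ℕ.+ n) ≡ a ^ᶠ m * a ^ᶠ n
  ^-+ a zero    n = sym (*-identityˡ _)
  ^-+ a (suc m) n = trans (cong (a *_) (^-+ a m n)) (sym (*-assoc a _ _))

  *-^ : ∀ a b n → (a * b) ^ᶠ n ≡ a ^ᶠ n * b ^ᶠ n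
  *-^ a b zero    = sym (*-identityˡ 1#)
  *-^ a b (suc n) = trans (cong ((a * b) *_) (*-^ a b n))
    (solve 4 (λ a b x y → (a :* b) :* (x :* y) := (a :* x) :* (b :* y)) refl a b _ _)

  1^ : ∀ n → 1# ^ᶠ n ≡ 1#
  1^ zero    = refl
  1^ (suc n) = trans (*-identityˡ _) (1^ n)

  ^-* : ∀ a m n → a ^ᶠ (m ℕ.* n) ≡ (a ^ᶠ m) ^ᶠ n
  ^-* a zero    n = sym (1^ n)
  ^-* a (suc m) n = begin
    a ^ᶠ (n ℕ.+ m ℕ.* n)     ≡⟨ ^-+ a n (m ℕ.* n) ⟩
    a ^ᶠ n * a ^ᶠ (m ℕ.* n)  ≡⟨ cong (a ^ᶠ n *_) (^-* a m n) ⟩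
    a ^ᶠ n * (a ^ᶠ m) ^ᶠ n   ≡⟨ sym (*-^ a (a ^ᶠ m) n) ⟩
    (a * a ^ᶠ m) ^ᶠ n        ∎

  ^-nonzero : ∀ {a} n → a ≢ 0# → a ^ᶠ n ≢ 0#
  ^-nonzero zero    a≢0 1≡0 = 0≢1 (sym 1≡0)
  ^-nonzero (suc n) a≢0     = *-nonzero a≢0 (^-nonzero n a≢0)

  ^-zero : ∀ {a} n → a ^ᶠ suc n ≡ 0# → a ≡ 0#
  ^-zero {a} n aⁿ⁺¹≡0 with a ≟ 0#
  ... | yes a≡0 = a≡0
  ... | no  a≢0 = ⊥-elim (^-nonzero (suc n) a≢0 aⁿ⁺¹≡0)

  fromℕ-^ : ∀ m n → fromℕ (m ℕ.^ n) ≡ fromℕ m ^ᶠ n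
  fromℕ-^ m zero    = refl
  fromℕ-^ m (suc n) = trans (fromℕ-* m (m ℕ.^ n)) (cong (fromℕ m *_) (fromℕ-^ m n))

  injective⇒surjective-Fin : ∀ {m} (f : Fin m → Fin m) → (∀ {i j} → f i ≡ f j → i ≡ j) →
                             ∀ j → ∃ λ i → f i ≡ j
  injective⇒surjective-Fin {suc m} f f-inj j with Fin.any? (λ i → f i Fin.≟ j)
  ... | yes hit = hit
  ... | no  miss
    with i , i' , i<i' , fi≡fi' ← Fin.pigeonhole (ℕP.n<1+n m) (λ i → punchOut {i = j} (λ e → miss (i , sym e)))
    = ⊥-elim (Fin.<⇒≢ i<i' (f-inj (Fin.punchOut-injective (λ e → miss (i , sym e)) (λ e → miss (i' , sym e)) fi≡fi')))

  private
    module card = Inverse card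

    from-injective : ∀ {i j} → card.from i ≡ card.from j → i ≡ j
    from-injective {i} {j} e = begin
      i                      ≡⟨ sym (card.strictlyInverseˡ i) ⟩
      card.to (card.from i)  ≡⟨ cong card.to e ⟩
      card.to (card.from j)  ≡⟨ card.strictlyInverseˡ j ⟩
      j                      ∎

    to-injective : ∀ {a b} → card.to a ≡ card.to b → a ≡ b
    to-injective {a} {b} e = begin
      a                      ≡⟨ sym (card.strictlyInverseʳ a) ⟩
      card.from (card.to a)  ≡⟨ cong card.from e ⟩
      card.from (card.to b)  ≡⟨ card.strictlyInverseʳ b ⟩
      b                      ∎

  injective⇒surjective : (f : Carrier → Carrier) → (∀ {a b} → f a ≡ f b → a ≡ b) →
                         ∀ b → ∃ λ a → f a ≡ b
  injective⇒surjective f f-inj b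
    with i , fi≡b ← injective⇒surjective-Fin (λ i → card.to (f (card.from i)))
           (λ e → from-injective (f-inj (to-injective e))) (card.to b)
    = card.from i , to-injective fi≡b

  ×ᵤ≡fromℕ* : ∀ n a → n ×ᵤ a ≡ fromℕ n * a
  ×ᵤ≡fromℕ* n a = begin
    n ×ᵤ a         ≡⟨ cong (n ×ᵤ_) (sym (*-identityˡ a)) ⟩
    n ×ᵤ (1# * a)  ≡⟨ sym (×-assoc-* n 1# a) ⟩
    (n ×ᵤ 1#) * a  ≡⟨ cong (_* a) (×ᵤ≈× n 1#) ⟩
    fromℕ n * a    ∎

  translationPermutation : Carrier → Perm.Permutation q q
  translationPermutation a = Perm.permutation
    (λ i → card.to (a + card.from i)) (λ i → card.to (card.from i - a))
    (λ i → trans (cong (λ t → card.to (a + t)) (card.strictlyInverseʳ _))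
           (trans (cong card.to (solve 2 (λ a b → a :+ (b :- a) := b) refl a (card.from i))) (card.strictlyInverseˡ i)))
    (λ i → trans (cong (λ t → card.to (t - a)) (card.strictlyInverseʳ _))
           (trans (cong card.to (solve 2 (λ a b → (a :+ b) :- a := b) refl a (card.from i))) (card.strictlyInverseˡ i)))

  fromℕ-card : ∀ a → fromℕ q * a ≡ 0#
  fromℕ-card a = +-cancelʳ Σ (fromℕ q * a) 0# (begin
    fromℕ q * a + Σ                                ≡⟨ cong (_+ Σ) (sym (×ᵤ≡fromℕ* q a)) ⟩
    q ×ᵤ a + Σ                                     ≡⟨ cong (_+ Σ) (sym (sum-replicate q)) ⟩
    sum {q} (λ _ → a) + Σ                          ≡⟨ sym (∑-distrib-+ (λ _ → a) card.from) ⟩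
    sum (λ i → a + card.from i)                    ≡⟨ sum-cong-≗ {q} (λ i → sym (card.strictlyInverseʳ _)) ⟩
    sum (λ i → card.from (card.to (a + card.from i))) ≡⟨ sym (sum-permute card.from (translationPermutation a)) ⟩
    Σ                                              ≡⟨ sym (+-identityˡ Σ) ⟩
    0# + Σ                                         ∎)
    where
    Σ = sum card.from

  fromℕ-characteristic : ∀ p d → q ≡ p ℕ.^ d → 1 ℕ.≤ d → fromℕ p ≡ 0#
  fromℕ-characteristic p (suc d) q≡pᵈ _ = ^-zero d (begin
    fromℕ p ^ᶠ suc d      ≡⟨ sym (fromℕ-^ p (suc d)) ⟩
    fromℕ (p ℕ.^ suc d)   ≡⟨ cong fromℕ (sym q≡pᵈ) ⟩
    fromℕ q               ≡⟨ sym (*-identityʳ _) ⟩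
    fromℕ q * 1#          ≡⟨ fromℕ-card 1# ⟩
    0#                    ∎)

  fromℕ-multiple : ∀ {m} a → fromℕ m ≡ 0# → fromℕ (a ℕ.* m) ≡ 0#
  fromℕ-multiple {m} a m≡0 = trans (fromℕ-* a m) (trans (cong (fromℕ a *_) m≡0) (zeroʳ _))

  fromℕ-1+multiple : ∀ {m} a → fromℕ m ≡ 0# → fromℕ (1 ℕ.+ a ℕ.* m) ≡ 1#
  fromℕ-1+multiple {m} a m≡0 =
    trans (fromℕ-+ 1 (a ℕ.* m)) (trans (cong (1# +_) (fromℕ-multiple a m≡0)) (+-identityʳ 1#))

  module Frobenius {p} (p-prime : Prime p) (char-p : fromℕ p ≡ 0#) where
    open import Data.Fin using (zero; suc; inject₁) renaming (fromℕ to last)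
    open import Data.Nat.Combinatorics using (_C_; nCn≡1)
    open PrimeBinomial using (prime⇒2+; prime∣pCk)
    open import Algebra.Properties.Semiring.Exp (CommutativeRing.semiring commutativeRing)
      using () renaming (_^_ to _^ᵤ_)
    import Algebra.Properties.CommutativeSemiring.Binomial (CommutativeRing.commutativeSemiring commutativeRing)
      as Binomial

    frob : Carrier → Carrier
    frob a = a ^ᶠ p

    ^ᵤ≡^ᶠ : ∀ a n → a ^ᵤ n ≡ a ^ᶠ n
    ^ᵤ≡^ᶠ a zero    = refl
    ^ᵤ≡^ᶠ a (suc n) = cong (a *_) (^ᵤ≡^ᶠ a n)

    sum-endpoints : ∀ n (t : Fin (suc (suc n)) → Carrier) → (∀ i → t (suc (inject₁ i)) ≡ 0#) →
                    sum t ≡ t zero + t (last (suc n))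
    sum-endpoints n t inner≡0 = cong (t zero +_) (begin
      sum (λ i → t (suc i))                                   ≡⟨ sum-init-last (λ i → t (suc i)) ⟩
      sum (λ i → t (suc (inject₁ i))) + t (last (suc n))     ≡⟨ cong (_+ t (last (suc n))) (sum-cong-≗ inner≡0) ⟩
      sum {n} (λ _ → 0#) + t (last (suc n))                  ≡⟨ cong (_+ t (last (suc n))) (sum-replicate-zero n) ⟩
      0# + t (last (suc n))                                  ≡⟨ +-identityˡ _ ⟩
      t (last (suc n))                                       ∎)

    inner-binomial≡0 : ∀ {k} z → 0 ℕ.< k → k ℕ.< p → (p C k) ×ᵤ z ≡ 0#
    inner-binomial≡0 {k} z 0<k k<p with divides c pCk≡cp ← prime∣pCk p-prime 0<k k<p = begin
      (p C k) ×ᵤ z       ≡⟨ ×ᵤ≡fromℕ* (p C k) z ⟩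
      fromℕ (p C k) * z  ≡⟨ cong (λ m → fromℕ m * z) pCk≡cp ⟩
      fromℕ (c ℕ.* p) * z ≡⟨ cong (_* z) (fromℕ-multiple c char-p) ⟩
      0# * z             ≡⟨ zeroˡ z ⟩
      0#                 ∎

    frob-+ : ∀ a b → frob (a + b) ≡ frob a + frob b
    frob-+ a b with m , refl ← prime⇒2+ p-prime = begin
      (a + b) ^ᶠ p                                    ≡⟨ sym (^ᵤ≡^ᶠ (a + b) p) ⟩
      (a + b) ^ᵤ p                                    ≡⟨ Binomial.theorem p a b ⟩
      Binomial.binomialExpansion a b p                ≡⟨ sum-endpoints (suc m) (term) inner≡0 ⟩
      term zero + term (last p)                       ≡⟨ cong₂ _+_ first≡bᵖ last≡aᵖ ⟩
      b ^ᶠ p + a ^ᶠ p                                 ≡⟨ +-comm _ _ ⟩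
      a ^ᶠ p + b ^ᶠ p                                 ∎
      where
      term = Binomial.binomialTerm a b p
      inner≡0 : ∀ i → term (suc (inject₁ i)) ≡ 0#
      inner≡0 i = inner-binomial≡0 _ (ℕ.s≤s ℕ.z≤n)
        (ℕ.s≤s (subst (ℕ._< suc m) (sym (Fin.toℕ-inject₁ i)) (Fin.toℕ<n i)))
      first≡bᵖ : term zero ≡ b ^ᶠ p
      first≡bᵖ = begin
        1 ×ᵤ (1# * b ^ᵤ p)  ≡⟨ solve 1 (λ z → :1 :* z :+ :0 := z) refl (b ^ᵤ p) ⟩
        b ^ᵤ p              ≡⟨ ^ᵤ≡^ᶠ b p ⟩
        b ^ᶠ p              ∎
      last≡aᵖ : term (last p) ≡ a ^ᶠ p
      last≡aᵖ = begin
        (p C toℕ (last p)) ×ᵤ (a ^ᵤ toℕ (last p) * b ^ᵤ (p ℕ.∸ toℕ (last p)))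
          ≡⟨ cong (λ k → (p C k) ×ᵤ (a ^ᵤ k * b ^ᵤ (p ℕ.∸ k))) (Fin.toℕ-fromℕ p) ⟩
        (p C p) ×ᵤ (a ^ᵤ p * b ^ᵤ (p ℕ.∸ p))
          ≡⟨ cong₂ (λ c k → c ×ᵤ (a ^ᵤ p * b ^ᵤ k)) (nCn≡1 p) (ℕP.n∸n≡0 p) ⟩
        1 ×ᵤ (a ^ᵤ p * 1#)  ≡⟨ solve 1 (λ z → z :* :1 :+ :0 := z) refl (a ^ᵤ p) ⟩
        a ^ᵤ p              ≡⟨ ^ᵤ≡^ᶠ a p ⟩
        a ^ᶠ p              ∎

    frob-* : ∀ a b → frob (a * b) ≡ frob a * frob b
    frob-* a b = *-^ a b p

    frob-^ : ∀ a k → frob (a ^ᶠ k) ≡ a ^ᶠ (p ℕ.* k)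
    frob-^ a k = trans (sym (^-* a k p)) (cong (a ^ᶠ_) (ℕP.*-comm k p))

    frob-0 : frob 0# ≡ 0#
    frob-0 with m , refl ← prime⇒2+ p-prime = zeroˡ _

    frob-- : ∀ a b → frob (a - b) ≡ frob a - frob b
    frob-- a b = +-cancelʳ (frob b) (frob (a - b)) (frob a - frob b) (begin
      frob (a - b) + frob b      ≡⟨ sym (frob-+ (a - b) b) ⟩
      frob ((a - b) + b)         ≡⟨ cong frob (solve 2 (λ a b → (a :- b) :+ b := a) refl a b) ⟩
      frob a                     ≡⟨ solve 2 (λ a b → a := (a :- b) :+ b) refl (frob a) (frob b) ⟩
      (frob a - frob b) + frob b ∎)

    frob-injective : ∀ {a b} → frob a ≡ frob b → a ≡ b
    frob-injective {a} {b} e with m , refl ← prime⇒2+ p-prime =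
      x∙y⁻¹≈ε⇒x≈y a b (^-zero (suc m) (trans (frob-- a b) (x≈y⇒x∙y⁻¹≈ε e)))

    frob-surjective : ∀ b → ∃ λ a → frob a ≡ b
    frob-surjective = injective⇒surjective frob frob-injective

  module PrimeSubfield {p} (p-prime : Prime p) (char-p : fromℕ p ≡ 0#) where
    open import Data.Nat.GCD using (module Bézout)
    open import Data.Nat.Coprimality using (prime⇒coprime; coprime-Bézout)

    fromℕ-nonzero : ∀ {m} → 0 ℕ.< m → m ℕ.< p → fromℕ m ≢ 0#
    fromℕ-nonzero {m@(suc _)} _ m<p m≡0 with coprime-Bézout (prime⇒coprime p-prime m<p)
    ... | Bézout.+- x y 1+ym≡xp =
      0≢1 (trans (sym (fromℕ-multiple x char-p)) (trans (cong fromℕ (sym 1+ym≡xp)) (fromℕ-1+multiple y m≡0)))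
    ... | Bézout.-+ x y 1+xp≡ym =
      0≢1 (trans (sym (fromℕ-multiple y m≡0)) (trans (cong fromℕ (sym 1+xp≡ym)) (fromℕ-1+multiple x char-p)))

    fromℕ-∸ : ∀ {i j} → i ℕ.≤ j → fromℕ i ≡ fromℕ j → fromℕ (j ℕ.∸ i) ≡ 0#
    fromℕ-∸ {i} {j} i≤j e = +-cancelˡ (fromℕ i) (fromℕ (j ℕ.∸ i)) 0# (begin
      fromℕ i + fromℕ (j ℕ.∸ i)  ≡⟨ sym (fromℕ-+ i (j ℕ.∸ i)) ⟩
      fromℕ (i ℕ.+ (j ℕ.∸ i))    ≡⟨ cong fromℕ (ℕP.m+[n∸m]≡n i≤j) ⟩
      fromℕ j                    ≡⟨ sym e ⟩
      fromℕ i                    ≡⟨ sym (+-identityʳ _) ⟩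
      fromℕ i + 0#               ∎)

    fromℕ-injective : ∀ {i j} → i ℕ.< p → j ℕ.< p → fromℕ i ≡ fromℕ j → i ≡ j
    fromℕ-injective {i} {j} i<p j<p e with ℕP.<-cmp i j
    ... | tri≈ _ i≡j _ = i≡j
    ... | tri< i<j _ _ = ⊥-elim (fromℕ-nonzero (ℕP.m<n⇒0<n∸m i<j)
                           (ℕP.≤-<-trans (ℕP.m∸n≤m j i) j<p) (fromℕ-∸ (ℕP.<⇒≤ i<j) e))
    ... | tri> _ _ j<i = ⊥-elim (fromℕ-nonzero (ℕP.m<n⇒0<n∸m j<i)
                           (ℕP.≤-<-trans (ℕP.m∸n≤m i j) i<p) (fromℕ-∸ (ℕP.<⇒≤ j<i) (sym e)))

    fromℕ-surjective : q ≡ p → ∀ a → ∃ λ m → fromℕ m ≡ a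
    fromℕ-surjective refl a
      with i , e ← injective⇒surjective-Fin (λ i → card.to (fromℕ (toℕ i)))
             (λ e → Fin.toℕ-injective (fromℕ-injective (Fin.toℕ<n _) (Fin.toℕ<n _) (to-injective e)))
             (card.to a)
      = toℕ i , to-injective e

  order≡3 : ∀ {ξ n} → HasOrder F ξ n → 1 ℕ.< n → ξ ^ᶠ 3 ≡ 1# → n ≡ 3
  order≡3 {ξ} {n} (_ , ξⁿ≡1 , minimal) 1<n ξ³≡1 with ℕP.<-cmp n 3
  ... | tri≈ _ n≡3 _ = n≡3
  ... | tri> _ _ 3<n = ⊥-elim (minimal 3 (ℕ.s≤s ℕ.z≤n) 3<n ξ³≡1)
  ... | tri< n<3 _ _ = ⊥-elim (minimal 1 ℕP.≤-refl 1<n (begin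
    ξ * 1#             ≡⟨ cong (ξ *_) (sym ξ²≡1) ⟩
    ξ ^ᶠ 3             ≡⟨ ξ³≡1 ⟩
    1#                 ∎))
    where
    ξ²≡1 : ξ ^ᶠ 2 ≡ 1#
    ξ²≡1 = subst (λ m → ξ ^ᶠ m ≡ 1#) (ℕP.≤-antisym (ℕP.≤-pred n<3) 1<n) ξⁿ≡1

-- The group G_S and its automorphisms

module PaleyGroup {q : ℕ} (F : FiniteField q) (n : ℕ) (ξ : FiniteField.Carrier F)
                  (1≤n : 1 ≤ n) (ξⁿ≡1 : FiniteField._^ᶠ_ F ξ n ≡ FiniteField.1# F) where
  open FieldProperties F
  open Paley F n ξ public
  open import Data.Nat as ℕ using (zero; suc)
  import Data.Nat.Properties as ℕP
  open import Data.Product using (∃)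
  open import Data.Nat.Divisibility using (_∣_; divides)
  open import Level using (0ℓ)
  open import Relation.Binary.Bundles using (Setoid)
  import Relation.Binary.Reasoning.Setoid
  open import Relation.Binary.PropositionalEquality

  -- `_≈_` is defined by pattern matching, so it does not determine its arguments; this wrapper does.
  infix 4 _≋_
  record _≋_ (g h : G) : Set where
    constructor ⟪_⟫
    field unwrap : g ≈ h
  open _≋_ public

  ≋-refl : ∀ {g} → g ≋ g
  ≋-refl = ⟪ refl , refl ⟫

  ≋-sym : ∀ {g h} → g ≋ h → h ≋ g
  ≋-sym ⟪ e₁ , e₂ ⟫ = ⟪ sym e₁ , sym e₂ ⟫

  ≋-trans : ∀ {g h k} → g ≋ h → h ≋ k → g ≋ k
  ≋-trans ⟪ e₁ , e₂ ⟫ ⟪ e₃ , e₄ ⟫ = ⟪ trans e₁ e₃ , trans e₂ e₄ ⟫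

  ≋-setoid : Setoid 0ℓ 0ℓ
  ≋-setoid = record { Carrier = G ; _≈_ = _≋_
                    ; isEquivalence = record { refl = ≋-refl ; sym = ≋-sym ; trans = ≋-trans } }

  module ≋-Reasoning = Relation.Binary.Reasoning.Setoid ≋-setoid

  linearPart : G → Carrier
  linearPart (k , _) = ξ ^ᶠ k

  ≋⇒linearPart≡ : ∀ {g h} → g ≋ h → linearPart g ≡ linearPart h
  ≋⇒linearPart≡ ⟪ e , _ ⟫ = e

  linearPart-· : ∀ g h → linearPart (g · h) ≡ linearPart g * linearPart h
  linearPart-· (k , _) (k' , _) = ^-+ ξ k k'

  linearPart-pow : ∀ g c → linearPart (pow g c) ≡ linearPart g ^ᶠ c
  linearPart-pow g zero    = refl
  linearPart-pow g (suc c) = trans (linearPart-· g (pow g c)) (cong (linearPart g *_) (linearPart-pow g c))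

  ξ^kn≡1 : ∀ k → ξ ^ᶠ (k ℕ.* n) ≡ 1#
  ξ^kn≡1 k = begin
    ξ ^ᶠ (k ℕ.* n)   ≡⟨ cong (ξ ^ᶠ_) (ℕP.*-comm k n) ⟩
    ξ ^ᶠ (n ℕ.* k)   ≡⟨ ^-* ξ n k ⟩
    (ξ ^ᶠ n) ^ᶠ k    ≡⟨ cong (_^ᶠ k) ξⁿ≡1 ⟩
    1# ^ᶠ k          ≡⟨ 1^ k ⟩
    1#               ∎
    where open ≡-Reasoning

  linearPart-inv : ∀ g → linearPart (inv g) * linearPart g ≡ 1#
  linearPart-inv (k , _) = begin
    ξ ^ᶠ (k ℕ.* (n ℕ.∸ 1)) * ξ ^ᶠ k  ≡⟨ sym (^-+ ξ (k ℕ.* (n ℕ.∸ 1)) k) ⟩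
    ξ ^ᶠ (k ℕ.* (n ℕ.∸ 1) ℕ.+ k)     ≡⟨ cong (ξ ^ᶠ_) k[n-1]+k≡kn ⟩
    ξ ^ᶠ (k ℕ.* n)                   ≡⟨ ξ^kn≡1 k ⟩
    1#                               ∎
    where
    open ≡-Reasoning
    k[n-1]+k≡kn : k ℕ.* (n ℕ.∸ 1) ℕ.+ k ≡ k ℕ.* n
    k[n-1]+k≡kn = begin
      k ℕ.* (n ℕ.∸ 1) ℕ.+ k          ≡⟨ cong (k ℕ.* (n ℕ.∸ 1) ℕ.+_) (sym (ℕP.*-identityʳ k)) ⟩
      k ℕ.* (n ℕ.∸ 1) ℕ.+ k ℕ.* 1    ≡⟨ sym (ℕP.*-distribˡ-+ k (n ℕ.∸ 1) 1) ⟩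
      k ℕ.* (n ℕ.∸ 1 ℕ.+ 1)          ≡⟨ cong (k ℕ.*_) (ℕP.m∸n+n≡m 1≤n) ⟩
      k ℕ.* n                        ∎

  ^-cong-* : ∀ {a b} m → ξ ^ᶠ a ≡ ξ ^ᶠ b → ξ ^ᶠ (a ℕ.* m) ≡ ξ ^ᶠ (b ℕ.* m)
  ^-cong-* {a} {b} m e = trans (^-* ξ a m) (trans (cong (_^ᶠ m) e) (sym (^-* ξ b m)))

  ·-cong : ∀ {g g' h h'} → g ≋ g' → h ≋ h' → g · h ≋ g' · h'
  ·-cong {k , b} {k' , _} {j , c} {j' , _} ⟪ e₁ , refl ⟫ ⟪ e₂ , refl ⟫ = ⟪
    trans (^-+ ξ k j) (trans (cong₂ _*_ e₁ e₂) (sym (^-+ ξ k' j'))) ,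
    cong (λ t → t * c + b) e₁ ⟫

  inv-cong : ∀ {g h} → g ≋ h → inv g ≋ inv h
  inv-cong {k , b} {k' , _} ⟪ e , refl ⟫ = ⟪ ^-cong-* {k} {k'} (n ℕ.∸ 1) e ,
    cong (λ t → - (t * b)) (^-cong-* {k} {k'} (n ℕ.∸ 1) e) ⟫

  ·-assoc : ∀ g h k → (g · h) · k ≋ g · (h · k)
  ·-assoc (a , s) (b , t) (c , u) = ⟪ cong (ξ ^ᶠ_) (ℕP.+-assoc a b c) , (begin
    ξ ^ᶠ (a ℕ.+ b) * u + (ξ ^ᶠ a * t + s)    ≡⟨ cong (λ X → X * u + (ξ ^ᶠ a * t + s)) (^-+ ξ a b) ⟩
    ξ ^ᶠ a * ξ ^ᶠ b * u + (ξ ^ᶠ a * t + s)   ≡⟨ solve 5 (λ A B s t u → A :* B :* u :+ (A :* t :+ s) := A :* (B :* u :+ t) :+ s)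
                                                   refl (ξ ^ᶠ a) (ξ ^ᶠ b) s t u ⟩
    ξ ^ᶠ a * (ξ ^ᶠ b * u + t) + s            ∎) ⟫
    where open ≡-Reasoning

  ·-identityˡ : ∀ g → e · g ≋ g
  ·-identityˡ (k , b) = ⟪ refl , trans (cong (_+ 0#) (*-identityˡ b)) (+-identityʳ b) ⟫

  ·-inverseˡ : ∀ g → inv g · g ≋ e
  ·-inverseˡ g@(k , b) = ⟪ trans (^-+ ξ (k ℕ.* (n ℕ.∸ 1)) k) (linearPart-inv g) ,
    solve 2 (λ A b → A :* b :+ :- (A :* b) := :0) refl (ξ ^ᶠ (k ℕ.* (n ℕ.∸ 1))) b ⟫

  idempotent⇒identity : ∀ g → g ≋ g · g → g ≋ e
  idempotent⇒identity g g≋gg = begin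
    g                  ≈⟨ ·-identityˡ g ⟨
    e · g              ≈⟨ ·-cong (·-inverseˡ g) ≋-refl ⟨
    (inv g · g) · g    ≈⟨ ·-assoc (inv g) g g ⟩
    inv g · (g · g)    ≈⟨ ·-cong ≋-refl g≋gg ⟨
    inv g · g          ≈⟨ ·-inverseˡ g ⟩
    e                  ∎
    where open ≋-Reasoning

  module IsoProperties {D₁ D₂ : Dessin} (I : Iso D₁ D₂) where
    open Iso I public using (φ)

    φ-cong : ∀ {g h} → g ≋ h → φ g ≋ φ h
    φ-cong {g} {h} ⟪ g≈h ⟫ = ⟪ Iso.φ-cong I g h g≈h ⟫

    φ-· : ∀ g h → φ (g · h) ≋ φ g · φ h
    φ-· g h = ⟪ Iso.φ-hom I g h ⟫

    φ-injective : ∀ {g h} → φ g ≋ φ h → g ≋ h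
    φ-injective {g} {h} ⟪ φg≈φh ⟫ = ⟪ Iso.φ-inj I g h φg≈φh ⟫

    φ-x : φ (proj₁ D₁) ≋ proj₁ D₂
    φ-x = ⟪ Iso.φ-x I ⟫

    φ-y : φ (proj₂ D₁) ≋ proj₂ D₂
    φ-y = ⟪ Iso.φ-y I ⟫

    φ-e : φ e ≋ e
    φ-e = idempotent⇒identity (φ e) (≋-trans (φ-cong (≋-sym (·-identityˡ e))) (φ-· e e))

    φ-pow : ∀ g c → φ (pow g c) ≋ pow (φ g) c
    φ-pow g zero    = φ-e
    φ-pow g (suc c) = ≋-trans (φ-· g (pow g c)) (·-cong ≋-refl (φ-pow g c))

  ≋⇒Iso : ∀ {u v u' v'} → u ≋ u' → v ≋ v' → Iso (u , v) (u' , v')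
  ≋⇒Iso ⟪ u≈u' ⟫ ⟪ v≈v' ⟫ = record
    { φ = λ g → g ; φ-cong = λ _ _ g≈h → g≈h ; φ-hom = λ _ _ → refl , refl
    ; φ-inj = λ _ _ g≈h → g≈h ; φ-surj = λ h → h , (refl , refl) ; φ-x = u≈u' ; φ-y = v≈v' }

  Iso-∘ : ∀ {D₁ D₂ D₃} → Iso D₁ D₂ → Iso D₂ D₃ → Iso D₁ D₃
  Iso-∘ I J = record
    { φ      = λ g → J.φ (I.φ g)
    ; φ-cong = λ g h g≈h → unwrap (J.φ-cong (I.φ-cong ⟪ g≈h ⟫))
    ; φ-hom  = λ g h → unwrap (≋-trans (J.φ-cong (I.φ-· g h)) (J.φ-· (I.φ g) (I.φ h)))
    ; φ-inj  = λ g h φg≈φh → unwrap (I.φ-injective (J.φ-injective ⟪ φg≈φh ⟫))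
    ; φ-surj = λ k → let (h , Jh≈k) = Iso.φ-surj J k ; (g , Ig≈h) = Iso.φ-surj I h
                     in g , unwrap (≋-trans (J.φ-cong (⟪_⟫ {I.φ g} {h} Ig≈h)) (⟪_⟫ {J.φ h} {k} Jh≈k))
    ; φ-x    = unwrap (≋-trans (J.φ-cong I.φ-x) J.φ-x)
    ; φ-y    = unwrap (≋-trans (J.φ-cong I.φ-y) J.φ-y)
    }
    where
    module I = IsoProperties I
    module J = IsoProperties J

  IsTranslation : G → Set
  IsTranslation g = linearPart g ≡ 1#

  translation-pow : ∀ {g} c → IsTranslation g → proj₂ (pow g c) ≡ fromℕ c * proj₂ g
  translation-pow         zero    _       = sym (zeroˡ _)
  translation-pow {k , b} (suc c) ξᵏ≡1 = begin
    ξ ^ᶠ k * proj₂ (pow (k , b) c) + b  ≡⟨ cong₂ (λ u v → u * v + b) ξᵏ≡1 (translation-pow c ξᵏ≡1) ⟩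
    1# * (fromℕ c * b) + b              ≡⟨ solve 2 (λ c b → :1 :* (c :* b) :+ b := (:1 :+ c) :* b) refl (fromℕ c) b ⟩
    (1# + fromℕ c) * b                  ≡⟨ cong (_* b) (sym (fromℕ-suc c)) ⟩
    fromℕ (suc c) * b                   ∎
    where open ≡-Reasoning

  -- As ξ^q = ξ, the translations are exactly the solutions of g^q = e, so automorphisms preserve them.
  module Translations (ξ^q≡ξ : ξ ^ᶠ q ≡ ξ) where

    translation⇒pow-q≋e : ∀ {g} → IsTranslation g → pow g q ≋ e
    translation⇒pow-q≋e {g} ξᵏ≡1 = ⟪ trans (linearPart-pow g q) (trans (cong (_^ᶠ q) ξᵏ≡1) (1^ q)) ,
                                   trans (translation-pow q ξᵏ≡1) (fromℕ-card _) ⟫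

    pow-q≋e⇒translation : ∀ {g} → pow g q ≋ e → IsTranslation g
    pow-q≋e⇒translation {g@(k , _)} gᵠ≋e = begin
      ξ ^ᶠ k                  ≡⟨ cong (_^ᶠ k) (sym ξ^q≡ξ) ⟩
      (ξ ^ᶠ q) ^ᶠ k           ≡⟨ sym (^-* ξ q k) ⟩
      ξ ^ᶠ (q ℕ.* k)          ≡⟨ cong (ξ ^ᶠ_) (ℕP.*-comm q k) ⟩
      ξ ^ᶠ (k ℕ.* q)          ≡⟨ ^-* ξ k q ⟩
      (ξ ^ᶠ k) ^ᶠ q           ≡⟨ sym (linearPart-pow g q) ⟩
      linearPart (pow g q)    ≡⟨ ≋⇒linearPart≡ gᵠ≋e ⟩
      1#                      ∎
      where open ≡-Reasoning

    module _ {D₁ D₂ : Dessin} (I : Iso D₁ D₂) where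
      open IsoProperties I

      φ-translation : ∀ {g} → IsTranslation g → IsTranslation (φ g)
      φ-translation {g} t = pow-q≋e⇒translation
        (≋-trans (≋-sym (φ-pow g q)) (≋-trans (φ-cong (translation⇒pow-q≋e t)) φ-e))

      linearPart-φ-coset : ∀ {b c g} → g ≋ τ b · pow x c → linearPart (φ g) ≡ linearPart (φ x) ^ᶠ c
      linearPart-φ-coset {b} {c} {g} g≋τxᶜ = begin
        linearPart (φ g)                               ≡⟨ ≋⇒linearPart≡ (≋-trans (φ-cong g≋τxᶜ) (φ-· _ _)) ⟩
        linearPart (φ (τ b) · φ (pow x c))             ≡⟨ linearPart-· (φ (τ b)) (φ (pow x c)) ⟩
        linearPart (φ (τ b)) * linearPart (φ (pow x c)) ≡⟨ cong₂ _*_ (φ-translation refl) (≋⇒linearPart≡ (φ-pow x c)) ⟩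
        1# * linearPart (pow (φ x) c)                  ≡⟨ *-identityˡ _ ⟩
        linearPart (pow (φ x) c)                       ≡⟨ linearPart-pow (φ x) c ⟩
        linearPart (φ x) ^ᶠ c                          ∎
        where open ≡-Reasoning

    colour-relation : ∀ {b c y u v} → y ≋ τ b · pow x c → Iso (x , y) (u , v) →
                      linearPart v ≡ linearPart u ^ᶠ c
    colour-relation {c = c} {y} {u} {v} y≋τxᶜ I = begin
      linearPart v          ≡⟨ ≋⇒linearPart≡ (≋-sym φ-y) ⟩
      linearPart (φ y)      ≡⟨ linearPart-φ-coset I {c = c} y≋τxᶜ ⟩
      linearPart (φ x) ^ᶠ c ≡⟨ cong (_^ᶠ c) (≋⇒linearPart≡ φ-x) ⟩
      linearPart u ^ᶠ c     ∎
      where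
      open ≡-Reasoning
      open IsoProperties I

  -- ψ is conjugation by the affine map t ↦ m t + a.
  module Conjugation (m a : Carrier) (m≢0 : m ≢ 0#) where
    ψ : G → G
    ψ (j , t) = (j , m * t + (a - ξ ^ᶠ j * a))

    ψ-cong : ∀ g h → g ≈ h → ψ g ≈ ψ h
    ψ-cong (j , t) (j' , _) (ξʲ≡ξʲ' , refl) = ξʲ≡ξʲ' , cong (λ X → m * t + (a - X * a)) ξʲ≡ξʲ'

    ψ-hom : ∀ g h → ψ (g · h) ≈ ψ g · ψ h
    ψ-hom (j , t) (j' , t') = refl , (begin
      m * (ξ ^ᶠ j * t' + t) + (a - ξ ^ᶠ (j ℕ.+ j') * a)
        ≡⟨ cong (λ X → m * (ξ ^ᶠ j * t' + t) + (a - X * a)) (^-+ ξ j j') ⟩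
      m * (ξ ^ᶠ j * t' + t) + (a - ξ ^ᶠ j * ξ ^ᶠ j' * a)
        ≡⟨ solve 6 (λ m a X Y t t' → m :* (X :* t' :+ t) :+ (a :- X :* Y :* a)
                                  := X :* (m :* t' :+ (a :- Y :* a)) :+ (m :* t :+ (a :- X :* a)))
                  refl m a (ξ ^ᶠ j) (ξ ^ᶠ j') t t' ⟩
      ξ ^ᶠ j * (m * t' + (a - ξ ^ᶠ j' * a)) + (m * t + (a - ξ ^ᶠ j * a)) ∎)
      where open ≡-Reasoning

    ψ-inj : ∀ g h → ψ g ≈ ψ h → g ≈ h
    ψ-inj (j , t) (j' , t') (ξʲ≡ξʲ' , ψt≡ψt') = ξʲ≡ξʲ' , *-cancelˡ t t' m≢0 (begin
      m * t                                 ≡⟨ solve 3 (λ m t c → m :* t := (m :* t :+ c) :- c) refl m t (a - ξ ^ᶠ j * a) ⟩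
      (m * t + (a - ξ ^ᶠ j * a)) - (a - ξ ^ᶠ j * a)   ≡⟨ cong₂ (λ u X → u - (a - X * a)) ψt≡ψt' ξʲ≡ξʲ' ⟩
      (m * t' + (a - ξ ^ᶠ j' * a)) - (a - ξ ^ᶠ j' * a) ≡⟨ solve 3 (λ m t c → (m :* t :+ c) :- c := m :* t) refl m t' (a - ξ ^ᶠ j' * a) ⟩
      m * t'                                ∎)
      where open ≡-Reasoning

    ψ-surj : ∀ h → ∃ λ g → ψ g ≈ h
    ψ-surj (j , u) with m⁻¹ , mm⁻¹≡1 ← inverse m m≢0 = (j , m⁻¹ * (u - c)) , refl , (begin
      m * (m⁻¹ * (u - c)) + c     ≡⟨ solve 4 (λ m m' u c → m :* (m' :* (u :- c)) :+ c := (m :* m') :* (u :- c) :+ c) refl m m⁻¹ u c ⟩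
      (m * m⁻¹) * (u - c) + c     ≡⟨ cong (λ z → z * (u - c) + c) mm⁻¹≡1 ⟩
      1# * (u - c) + c            ≡⟨ solve 2 (λ u c → :1 :* (u :- c) :+ c := u) refl u c ⟩
      u                           ∎)
      where
      open ≡-Reasoning
      c = a - ξ ^ᶠ j * a

    conjugationIso : ∀ u v → Iso (u , v) (ψ u , ψ v)
    conjugationIso u v = record
      { φ = ψ ; φ-cong = ψ-cong ; φ-hom = ψ-hom ; φ-inj = ψ-inj ; φ-surj = ψ-surj
      ; φ-x = refl , refl ; φ-y = refl , refl }

  cosetPairIso : ∀ {k b s₀ s₁} → ξ ^ᶠ k ≢ 1# → b ≢ 0# → s₀ ≢ s₁ →
                 Iso ((k , 0#) , (k , b)) ((k , s₀) , (k , s₁))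
  cosetPairIso {k} {b} {s₀} {s₁} ξᵏ≢1 b≢0 s₀≢s₁
    with b⁻¹ , bb⁻¹≡1 ← inverse b b≢0
       | ν , [1-ξᵏ]ν≡1 ← inverse (1# - ξ ^ᶠ k) (λ 1-ξᵏ≡0 → ξᵏ≢1 (sym (x∙y⁻¹≈ε⇒x≈y _ _ 1-ξᵏ≡0)))
    = Iso-∘ (Conjugation.conjugationIso m a m≢0 (k , 0#) (k , b)) (≋⇒Iso ⟪ refl , ψ0≡s₀ ⟫ ⟪ refl , ψb≡s₁ ⟫)
    where
    open ≡-Reasoning
    m = (s₁ - s₀) * b⁻¹
    a = s₀ * ν
    m≢0 : m ≢ 0#
    m≢0 = *-nonzero (λ s₁-s₀≡0 → s₀≢s₁ (sym (x∙y⁻¹≈ε⇒x≈y _ _ s₁-s₀≡0)))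
                    (λ b⁻¹≡0 → 0≢1 (trans (sym (zeroʳ b)) (trans (cong (b *_) (sym b⁻¹≡0)) bb⁻¹≡1)))
    ψ0≡s₀ : m * 0# + (a - ξ ^ᶠ k * a) ≡ s₀
    ψ0≡s₀ = begin
      m * 0# + (s₀ * ν - ξ ^ᶠ k * (s₀ * ν))  ≡⟨ solve 4 (λ m s ν X → m :* :0 :+ (s :* ν :- X :* (s :* ν)) := s :* ((:1 :- X) :* ν))
                                                   refl m s₀ ν (ξ ^ᶠ k) ⟩
      s₀ * ((1# - ξ ^ᶠ k) * ν)               ≡⟨ cong (s₀ *_) [1-ξᵏ]ν≡1 ⟩
      s₀ * 1#                                ≡⟨ *-identityʳ s₀ ⟩
      s₀                                     ∎
    ψb≡s₁ : m * b + (a - ξ ^ᶠ k * a) ≡ s₁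
    ψb≡s₁ = begin
      (s₁ - s₀) * b⁻¹ * b + (s₀ * ν - ξ ^ᶠ k * (s₀ * ν))
        ≡⟨ solve 6 (λ s r b' b ν X → (s :- r) :* b' :* b :+ (r :* ν :- X :* (r :* ν))
                                   := (s :- r) :* (b :* b') :+ r :* ((:1 :- X) :* ν)) refl s₁ s₀ b⁻¹ b ν (ξ ^ᶠ k) ⟩
      (s₁ - s₀) * (b * b⁻¹) + s₀ * ((1# - ξ ^ᶠ k) * ν)   ≡⟨ cong₂ (λ u w → (s₁ - s₀) * u + s₀ * w) bb⁻¹≡1 [1-ξᵏ]ν≡1 ⟩
      (s₁ - s₀) * 1# + s₀ * 1#                           ≡⟨ solve 2 (λ s r → (s :- r) :* :1 :+ r :* :1 := s) refl s₁ s₀ ⟩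
      s₁                                                 ∎

  module FrobeniusIso {p} (p-prime : Prime p) (char-p : fromℕ p ≡ 0#) (r : ℕ) (ξ^pr≡ξ : ξ ^ᶠ (p ℕ.* r) ≡ ξ) where
    open Frobenius p-prime char-p

    σ : G → G
    σ (j , t) = (p ℕ.* j , frob t)

    σ-cong : ∀ g h → g ≈ h → σ g ≈ σ h
    σ-cong (j , t) (j' , _) (ξʲ≡ξʲ' , refl) = trans (sym (frob-^ ξ j)) (trans (cong frob ξʲ≡ξʲ') (frob-^ ξ j')) , refl

    σ-hom : ∀ g h → σ (g · h) ≈ σ g · σ h
    σ-hom (j , t) (j' , t') = cong (ξ ^ᶠ_) (ℕP.*-distribˡ-+ p j j') ,
      trans (frob-+ _ t) (cong (_+ frob t) (trans (frob-* _ t') (cong (_* frob t') (frob-^ ξ j))))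

    σ-inj : ∀ g h → σ g ≈ σ h → g ≈ h
    σ-inj (j , t) (j' , t') (ξᵖʲ≡ξᵖʲ' , tᵖ≡t'ᵖ) =
      frob-injective (trans (frob-^ ξ j) (trans ξᵖʲ≡ξᵖʲ' (sym (frob-^ ξ j')))) , frob-injective tᵖ≡t'ᵖ

    σ-surj : ∀ h → ∃ λ g → σ g ≈ h
    σ-surj (j , u) with w , wᵖ≡u ← frob-surjective u = (r ℕ.* j , w) , ξ^prj≡ξʲ , wᵖ≡u
      where
      open ≡-Reasoning
      ξ^prj≡ξʲ : ξ ^ᶠ (p ℕ.* (r ℕ.* j)) ≡ ξ ^ᶠ j
      ξ^prj≡ξʲ = begin
        ξ ^ᶠ (p ℕ.* (r ℕ.* j))   ≡⟨ cong (ξ ^ᶠ_) (sym (ℕP.*-assoc p r j)) ⟩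
        ξ ^ᶠ (p ℕ.* r ℕ.* j)     ≡⟨ ^-* ξ (p ℕ.* r) j ⟩
        (ξ ^ᶠ (p ℕ.* r)) ^ᶠ j    ≡⟨ cong (_^ᶠ j) ξ^pr≡ξ ⟩
        ξ ^ᶠ j                   ∎

    frobeniusIso : ∀ u v → Iso (u , v) (σ u , σ v)
    frobeniusIso u v = record
      { φ = σ ; φ-cong = σ-cong ; φ-hom = σ-hom ; φ-inj = σ-inj ; φ-surj = σ-surj
      ; φ-x = refl , refl ; φ-y = refl , refl }

  -- Over the prime field an automorphism restricts to an additive, hence 𝔽ₚ-linear, map β on T;
  -- conjugating by x then shows that β(ξ b) is both ξ β(b) and (linear part of φ x) · β(b).
  module PrimeFieldRigidity {p} (p-prime : Prime p) (char-p : fromℕ p ≡ 0#) (q≡p : q ≡ p)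
                            (ξ^q≡ξ : ξ ^ᶠ q ≡ ξ) {v D} (I : Iso (x , v) D) where
    open PrimeSubfield p-prime char-p using (fromℕ-surjective)
    open Translations ξ^q≡ξ using (φ-translation)
    open IsoProperties I

    β : Carrier → Carrier
    β b = proj₂ (φ (τ b))

    φ-τ : ∀ b → φ (τ b) ≋ τ (β b)
    φ-τ b = ⟪ φ-translation I refl , refl ⟫

    β-+ : ∀ b b' → β (b + b') ≡ 1# * β b' + β b
    β-+ b b' = proj₂ (unwrap (≋-trans (φ-cong {τ (b + b')} {τ b · τ b'} ⟪ refl , solve 2 (λ b b' → b :+ b' := :1 :* b' :+ b) refl b b' ⟫)
                               (≋-trans (φ-· (τ b) (τ b')) (·-cong (φ-τ b) (φ-τ b')))))

    β-0 : β 0# ≡ 0#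
    β-0 = +-cancelˡ (β 0#) (β 0#) 0# (begin
      β 0# + β 0#          ≡⟨ solve 1 (λ u → u :+ u := :1 :* u :+ u) refl (β 0#) ⟩
      1# * β 0# + β 0#     ≡⟨ sym (β-+ 0# 0#) ⟩
      β (0# + 0#)          ≡⟨ cong β (+-identityˡ 0#) ⟩
      β 0#                 ≡⟨ sym (+-identityʳ _) ⟩
      β 0# + 0#            ∎)
      where open ≡-Reasoning

    β-fromℕ : ∀ m b → β (fromℕ m * b) ≡ fromℕ m * β b
    β-fromℕ zero    b = trans (cong β (zeroˡ b)) (trans β-0 (sym (zeroˡ _)))
    β-fromℕ (suc m) b = begin
      β (fromℕ (suc m) * b)         ≡⟨ cong (λ t → β (t * b)) (fromℕ-suc m) ⟩
      β ((1# + fromℕ m) * b)        ≡⟨ cong β (solve 2 (λ c b → (:1 :+ c) :* b := b :+ c :* b) refl (fromℕ m) b) ⟩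
      β (b + fromℕ m * b)           ≡⟨ β-+ b (fromℕ m * b) ⟩
      1# * β (fromℕ m * b) + β b    ≡⟨ cong (λ t → 1# * t + β b) (β-fromℕ m b) ⟩
      1# * (fromℕ m * β b) + β b    ≡⟨ solve 2 (λ c u → :1 :* (c :* u) :+ u := (:1 :+ c) :* u) refl (fromℕ m) (β b) ⟩
      (1# + fromℕ m) * β b          ≡⟨ cong (_* β b) (sym (fromℕ-suc m)) ⟩
      fromℕ (suc m) * β b           ∎
      where open ≡-Reasoning

    φ-conj : ∀ b → φ x · τ (β b) ≋ τ (β (ξ * b)) · φ x
    φ-conj b = begin
      φ x · τ (β b)          ≈⟨ ·-cong ≋-refl (φ-τ b) ⟨
      φ x · φ (τ b)          ≈⟨ φ-· x (τ b) ⟨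
      φ (x · τ b)            ≈⟨ φ-cong {x · τ b} {τ (ξ * b) · x} ⟪ refl , x·τb≡τξb·x ⟫ ⟩
      φ (τ (ξ * b) · x)      ≈⟨ φ-· (τ (ξ * b)) x ⟩
      φ (τ (ξ * b)) · φ x    ≈⟨ ·-cong (φ-τ (ξ * b)) ≋-refl ⟩
      τ (β (ξ * b)) · φ x    ∎
      where
      open ≋-Reasoning
      x·τb≡τξb·x : (ξ * 1#) * b + 0# ≡ 1# * 0# + ξ * b
      x·τb≡τξb·x = solve 2 (λ X b → (X :* :1) :* b :+ :0 := :1 :* :0 :+ X :* b) refl ξ b

    β-ξ : ∀ b → β (ξ * b) ≡ linearPart (φ x) * β b
    β-ξ b = +-cancelʳ s (β (ξ * b)) (linearPart (φ x) * β b) (begin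
      β (ξ * b) + s                   ≡⟨ solve 2 (λ t s → t :+ s := :1 :* s :+ t) refl (β (ξ * b)) s ⟩
      1# * s + β (ξ * b)              ≡⟨ sym (proj₂ (unwrap (φ-conj b))) ⟩
      linearPart (φ x) * β b + s      ∎)
      where
      open ≡-Reasoning
      s = proj₂ (φ x)

    β-1≢0 : β 1# ≢ 0#
    β-1≢0 β1≡0 = 0≢1 (sym (proj₂ (unwrap (φ-injective (≋-trans (φ-τ 1#) (≋-trans ⟪ refl , β1≡0 ⟫ (≋-sym φ-e)))))))

    linearPart-φx : linearPart (φ x) ≡ ξ
    linearPart-φx with m , fromℕm≡ξ ← fromℕ-surjective q≡p ξ = sym (*-cancelˡ ξ (linearPart (φ x)) β-1≢0 (begin
      β 1# * ξ                     ≡⟨ *-comm _ _ ⟩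
      ξ * β 1#                     ≡⟨ cong (_* β 1#) (sym fromℕm≡ξ) ⟩
      fromℕ m * β 1#               ≡⟨ sym (β-fromℕ m 1#) ⟩
      β (fromℕ m * 1#)             ≡⟨ cong (λ t → β (t * 1#)) fromℕm≡ξ ⟩
      β (ξ * 1#)                   ≡⟨ β-ξ 1# ⟩
      linearPart (φ x) * β 1#      ≡⟨ *-comm _ _ ⟩
      β 1# * linearPart (φ x)      ∎))
      where open ≡-Reasoning

  ξ^m≡ξ : ∀ {m} → 1 ≤ m → n ∣ m ℕ.∸ 1 → ξ ^ᶠ m ≡ ξ
  ξ^m≡ξ {m} 1≤m (divides k m-1≡kn) = begin
    ξ ^ᶠ m                     ≡⟨ cong (ξ ^ᶠ_) (sym (ℕP.m∸n+n≡m 1≤m)) ⟩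
    ξ ^ᶠ (m ℕ.∸ 1 ℕ.+ 1)       ≡⟨ cong (λ t → ξ ^ᶠ (t ℕ.+ 1)) m-1≡kn ⟩
    ξ ^ᶠ (k ℕ.* n ℕ.+ 1)       ≡⟨ ^-+ ξ (k ℕ.* n) 1 ⟩
    ξ ^ᶠ (k ℕ.* n) * (ξ * 1#)  ≡⟨ cong (_* (ξ * 1#)) (ξ^kn≡1 k) ⟩
    1# * (ξ * 1#)              ≡⟨ solve 1 (λ X → :1 :* (X :* :1) := X) refl ξ ⟩
    ξ                          ∎
    where open ≡-Reasoning

  valency-1⇒y∈S : ∀ {y v} → n ≡ 1 → Iso (x , y) (y , v) → InS y
  valency-1⇒y∈S {y} refl I = 0 , unwrap (≋-trans (≋-sym φ-x) (≋-trans (φ-cong x≋e) φ-e))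
    where
    open IsoProperties I
    x≋e : x ≋ e
    x≋e = ⟪ ξⁿ≡1 , refl ⟫

  module ColourEquations (ξ^q≡ξ : ξ ^ᶠ q ≡ ξ) {b c y} (y≋τxᶜ : y ≋ τ b · pow x c)
                         (swap : Iso (x , y) (y , x)) (rotate : Iso (x , y) (y , inv (x · y))) where
    open Translations ξ^q≡ξ using (colour-relation)
    open ≡-Reasoning

    X Y : Carrier
    X = linearPart x
    Y = linearPart y

    Y≡Xᶜ : Y ≡ X ^ᶠ c
    Y≡Xᶜ = colour-relation {c = c} y≋τxᶜ (≋⇒Iso ≋-refl ≋-refl)

    X≡Yᶜ : X ≡ Y ^ᶠ c
    X≡Yᶜ = colour-relation {c = c} y≋τxᶜ swap

    X²Y≡1 : X * (X * Y) ≡ 1#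
    X²Y≡1 = begin
      X * (X * Y)                           ≡⟨ cong (_* (X * Y)) (trans X≡Yᶜ (sym (colour-relation {c = c} y≋τxᶜ rotate))) ⟩
      linearPart (inv (x · y)) * (X * Y)    ≡⟨ cong (linearPart (inv (x · y)) *_) (sym (linearPart-· x y)) ⟩
      linearPart (inv (x · y)) * linearPart (x · y) ≡⟨ linearPart-inv (x · y) ⟩
      1#                                    ∎

    Y²X≡1 : Y * (Y * X) ≡ 1#
    Y²X≡1 = begin
      Y * (Y * X)                     ≡⟨ cong₂ (λ u v → u * (u * v)) Y≡Xᶜ X≡Yᶜ ⟩
      X ^ᶠ c * (X ^ᶠ c * Y ^ᶠ c)      ≡⟨ cong (X ^ᶠ c *_) (sym (*-^ X Y c)) ⟩
      X ^ᶠ c * (X * Y) ^ᶠ c           ≡⟨ sym (*-^ X (X * Y) c) ⟩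
      (X * (X * Y)) ^ᶠ c              ≡⟨ cong (_^ᶠ c) X²Y≡1 ⟩
      1# ^ᶠ c                         ≡⟨ 1^ c ⟩
      1#                              ∎

    ξ³≡1 : ξ ^ᶠ 3 ≡ 1#
    ξ³≡1 = begin
      ξ ^ᶠ 3                                ≡⟨ solve 1 (λ ξ → ξ :* (ξ :* (ξ :* :1)) := (ξ :* :1) :* ((ξ :* :1) :* (ξ :* :1)) :* :1) refl ξ ⟩
      X * (X * X) * 1#                      ≡⟨ cong (X * (X * X) *_) (sym Y²X≡1) ⟩
      X * (X * X) * (Y * (Y * X))           ≡⟨ solve 2 (λ X Y → X :* (X :* X) :* (Y :* (Y :* X)) := (X :* (X :* Y)) :* (X :* (X :* Y))) refl X Y ⟩
      (X * (X * Y)) * (X * (X * Y))         ≡⟨ cong₂ _*_ X²Y≡1 X²Y≡1 ⟩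
      1# * 1#                               ≡⟨ *-identityˡ 1# ⟩
      1#                                    ∎

    c≢0 : ξ ^ᶠ 2 ≢ 1# → c ≢ 0
    c≢0 ξ²≢1 c≡0 = ξ²≢1 (begin
      ξ * (ξ * 1#)     ≡⟨ solve 1 (λ ξ → ξ :* (ξ :* :1) := (ξ :* :1) :* ((ξ :* :1) :* :1)) refl ξ ⟩
      X * (X * 1#)     ≡⟨ cong (λ t → X * (X * t)) (sym (trans Y≡Xᶜ (cong (X ^ᶠ_) c≡0))) ⟩
      X * (X * Y)      ≡⟨ X²Y≡1 ⟩
      1#               ∎)

    c≢2 : ξ ^ᶠ 1 ≢ 1# → c ≢ 2
    c≢2 ξ¹≢1 c≡2 = ξ¹≢1 (begin
      ξ * 1#                        ≡⟨ sym (*-identityˡ _) ⟩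
      1# * (ξ * 1#)                 ≡⟨ cong (_* (ξ * 1#)) (sym ξ³≡1) ⟩
      ξ ^ᶠ 3 * (ξ * 1#)             ≡⟨ solve 1 (λ ξ → ξ :* (ξ :* (ξ :* :1)) :* (ξ :* :1)
                                                    := (ξ :* :1) :* ((ξ :* :1) :* ((ξ :* :1) :* ((ξ :* :1) :* :1)))) refl ξ ⟩
      X * (X * (X * (X * 1#)))      ≡⟨ cong (λ t → X * (X * t)) (sym (trans Y≡Xᶜ (cong (X ^ᶠ_) c≡2))) ⟩
      X * (X * Y)                   ≡⟨ X²Y≡1 ⟩
      1#                            ∎)

  mirror-over-prime-field : ∀ {p} → Prime p → fromℕ p ≡ 0# → q ≡ p → ξ ^ᶠ q ≡ ξ →
                            ∀ {y v} → Iso (x , y) (inv x , v) → ξ ^ᶠ 2 ≡ 1#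
  mirror-over-prime-field p-prime char-p q≡p ξ^q≡ξ I = begin
    ξ * (ξ * 1#)                        ≡⟨ cong (_* (ξ * 1#)) (sym linearPart-inv-x≡ξ) ⟩
    linearPart (inv x) * linearPart x   ≡⟨ linearPart-inv x ⟩
    1#                                  ∎
    where
    open ≡-Reasoning
    open IsoProperties I using (φ-x)
    open PrimeFieldRigidity p-prime char-p q≡p ξ^q≡ξ I using (linearPart-φx)
    linearPart-inv-x≡ξ : linearPart (inv x) ≡ ξ
    linearPart-inv-x≡ξ = trans (sym (≋⇒linearPart≡ φ-x)) linearPart-φx

-- Sufficiency

module ValencyThree {q : ℕ} (F : FiniteField q) {ξ : FiniteField.Carrier F} (ξ-order : HasOrder F ξ 3)
                {p : ℕ} (p-prime : Prime p) (char-p : FieldProperties.fromℕ F p ≡ FiniteField.0# F)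
                (p%3≡2 : p % 3 ≡ 2) where
  open FieldProperties F
  open PaleyGroup F 3 ξ (proj₁ ξ-order) (proj₁ (proj₂ ξ-order))
  open Frobenius p-prime char-p using (frob; frob-0; frob-injective)
  open import Data.Nat as ℕ using (s≤s; z≤n)
  import Data.Nat.Properties as ℕP
  open import Data.Nat.DivMod using (_/_)
  open import Relation.Binary.PropositionalEquality
  open Arithmetic using (%3≡2⇒≡2+[/3]*3; %3≡2⇒*2≡1+[1+[/3]*2]*3)

  ξ³≡1 : ξ ^ᶠ 3 ≡ 1#
  ξ³≡1 = proj₁ (proj₂ ξ-order)

  ξ¹≢1 : ξ ^ᶠ 1 ≢ 1#
  ξ¹≢1 = proj₂ (proj₂ ξ-order) 1 (s≤s z≤n) (s≤s (s≤s z≤n))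

  ξ²≢1 : ξ ^ᶠ 2 ≢ 1#
  ξ²≢1 = proj₂ (proj₂ ξ-order) 2 (s≤s z≤n) (s≤s (s≤s (s≤s z≤n)))

  ξ≢0 : ξ ≢ 0#
  ξ≢0 ξ≡0 = 0≢1 (trans (sym (zeroˡ _)) (trans (cong (_* ξ ^ᶠ 2) (sym ξ≡0)) ξ³≡1))

  ξ^[r+k*3]≡ξ^r : ∀ r k → ξ ^ᶠ (r ℕ.+ k ℕ.* 3) ≡ ξ ^ᶠ r
  ξ^[r+k*3]≡ξ^r r k = trans (^-+ ξ r (k ℕ.* 3)) (trans (cong (ξ ^ᶠ r *_) (ξ^kn≡1 k)) (*-identityʳ _))

  ξ^p≡ξ² : ξ ^ᶠ (p ℕ.* 1) ≡ ξ ^ᶠ 2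
  ξ^p≡ξ² = trans (cong (ξ ^ᶠ_) (trans (ℕP.*-identityʳ p) (%3≡2⇒≡2+[/3]*3 p p%3≡2))) (ξ^[r+k*3]≡ξ^r 2 (p / 3))

  ξ^2p≡ξ : ξ ^ᶠ (p ℕ.* 2) ≡ ξ
  ξ^2p≡ξ = trans (cong (ξ ^ᶠ_) (%3≡2⇒*2≡1+[1+[/3]*2]*3 p p%3≡2)) (trans (ξ^[r+k*3]≡ξ^r 1 (1 ℕ.+ p / 3 ℕ.* 2)) (*-identityʳ ξ))

  open FrobeniusIso p-prime char-p 2 ξ^2p≡ξ using (frobeniusIso)

  record DistinctInCoset (D : Dessin) : Set where
    constructor distinct
    field
      {s₀ s₁} : Carrier
      fst≋    : proj₁ D ≋ (1 , s₀)
      snd≋    : proj₂ D ≋ (1 , s₁)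
      s₀≢s₁   : s₀ ≢ s₁

  flip : ∀ {u v} → DistinctInCoset (u , v) → DistinctInCoset (v , u)
  flip (distinct u≋ v≋ s₀≢s₁) = distinct v≋ u≋ (λ s₁≡s₀ → s₀≢s₁ (sym s₁≡s₀))

  module _ {b y} (b≢0 : b ≢ 0#) (y≋ : y ≋ (1 , b)) where

    z≋ : inv (x · y) ≋ (1 , - (ξ * ξ * b))
    z≋ = ≋-trans {h = inv (x · (1 , b))} (inv-cong (·-cong (≋-refl {x}) y≋)) ⟪ ξ^[r+k*3]≡ξ^r 1 1 , cong -_ ξ⁴[ξb+0]≡ξξb ⟫
      where
      ξ⁴[ξb+0]≡ξξb : ξ ^ᶠ 4 * (ξ ^ᶠ 1 * b + 0#) ≡ ξ * ξ * b
      ξ⁴[ξb+0]≡ξξb = begin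
        ξ ^ᶠ 4 * (ξ ^ᶠ 1 * b + 0#)   ≡⟨ solve 2 (λ ξ b → (ξ :* (ξ :* (ξ :* (ξ :* :1)))) :* ((ξ :* :1) :* b :+ :0)
                                                   := (ξ :* (ξ :* (ξ :* :1))) :* (ξ :* ξ :* b)) refl ξ b ⟩
        ξ ^ᶠ 3 * (ξ * ξ * b)         ≡⟨ cong (_* (ξ * ξ * b)) ξ³≡1 ⟩
        1# * (ξ * ξ * b)             ≡⟨ *-identityˡ _ ⟩
        ξ * ξ * b                    ∎
        where open ≡-Reasoning

    ξξb≢0 : ξ * ξ * b ≢ 0#
    ξξb≢0 = *-nonzero (*-nonzero ξ≢0 ξ≢0) b≢0

    -- b = −ξ²b would force ξ² = −1, hence ξ = ξ⁴ = 1.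
    b≢-ξξb : b ≢ - (ξ * ξ * b)
    b≢-ξξb b≡-ξξb = ξ¹≢1 (begin
      ξ * 1#                 ≡⟨ solve 1 (λ ξ → ξ :* :1 := ξ :* :1 :* :1) refl ξ ⟩
      ξ * 1# * 1#            ≡⟨ cong (ξ * 1# *_) (sym ξ³≡1) ⟩
      ξ * 1# * ξ ^ᶠ 3        ≡⟨ solve 1 (λ ξ → ξ :* :1 :* (ξ :* (ξ :* (ξ :* :1))) := (ξ :* ξ) :* (ξ :* ξ)) refl ξ ⟩
      (ξ * ξ) * (ξ * ξ)      ≡⟨ cong₂ _*_ ξξ≡-1 ξξ≡-1 ⟩
      - 1# * - 1#            ≡⟨ solve 0 (:- :1 :* :- :1 := :1) refl ⟩
      1#                     ∎)
      where
      open ≡-Reasoning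
      [1+ξξ]b≡0 : (1# + ξ * ξ) * b ≡ 0#
      [1+ξξ]b≡0 = begin
        (1# + ξ * ξ) * b         ≡⟨ solve 2 (λ ξ b → (:1 :+ ξ :* ξ) :* b := b :- :- (ξ :* ξ :* b)) refl ξ b ⟩
        b - - (ξ * ξ * b)        ≡⟨ x≈y⇒x∙y⁻¹≈ε b≡-ξξb ⟩
        0#                       ∎
      ξξ≡-1 : ξ * ξ ≡ - 1#
      ξξ≡-1 = +-inverseʳ-unique 1# (ξ * ξ) (*-zero-divisor [1+ξξ]b≡0 b≢0)

    xy : DistinctInCoset (x , y)
    xy = distinct ≋-refl y≋ (λ 0≡b → b≢0 (sym 0≡b))

    xz : DistinctInCoset (x , inv (x · y))
    xz = distinct ≋-refl z≋ (λ 0≡-ξξb → ξξb≢0 (trans (sym (-‿involutive _)) (trans (cong -_ (sym 0≡-ξξb)) -0#≈0#)))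

    yz : DistinctInCoset (y , inv (x · y))
    yz = distinct y≋ z≋ b≢-ξξb

    Ω-distinct : ∀ ω → DistinctInCoset (applyΩ ω (x , y))
    Ω-distinct idΩ  = xy
    Ω-distinct D01  = flip xy
    Ω-distinct D12  = xz
    Ω-distinct D02  = flip yz
    Ω-distinct D012 = yz
    Ω-distinct D210 = flip xz

    distinct⇒Iso : ∀ {D} → DistinctInCoset D → Iso (x , y) D
    distinct⇒Iso (distinct u≋ v≋ s₀≢s₁) =
      Iso-∘ (≋⇒Iso ≋-refl y≋) (Iso-∘ (cosetPairIso ξ¹≢1 b≢0 s₀≢s₁) (≋⇒Iso (≋-sym u≋) (≋-sym v≋)))

    -- σ sends the coset xT to x²T = x⁻¹T, where a second coset-pair isomorphism finishes.
    distinct⇒mirrorIso : ∀ {D} → DistinctInCoset D → Iso (x , y) (H-1 D)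
    distinct⇒mirrorIso (distinct {s₀} {s₁} u≋ v≋ s₀≢s₁) =
      Iso-∘ (≋⇒Iso ≋-refl y≋)
      (Iso-∘ (frobeniusIso (1 , 0#) (1 , b))
      (Iso-∘ (≋⇒Iso ⟪ ξ^p≡ξ² , frob-0 ⟫ ⟪ ξ^p≡ξ² , refl ⟫)
      (Iso-∘ (cosetPairIso ξ²≢1 frob-b≢0 t₀≢t₁)
             (≋⇒Iso (≋-sym (inv-cong u≋)) (≋-sym (inv-cong v≋))))))
      where
      frob-b≢0 : frob b ≢ 0#
      frob-b≢0 frob-b≡0 = b≢0 (frob-injective (trans frob-b≡0 (sym frob-0)))
      t₀≢t₁ : - (ξ ^ᶠ 2 * s₀) ≢ - (ξ ^ᶠ 2 * s₁)
      t₀≢t₁ t₀≡t₁ = s₀≢s₁ (*-cancelˡ s₀ s₁ (^-nonzero 2 ξ≢0) (-‿injective t₀≡t₁))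

    fullyInvariant : FullyInvariant (x , y)
    fullyInvariant (plain ω)  = distinct⇒Iso (Ω-distinct ω)
    fullyInvariant (mirror ω) = distinct⇒mirrorIso (Ω-distinct ω)

  colourConstant-1⇒fullyInvariant : ∀ {y} → ¬ InS y → ColourConstant y 1 → FullyInvariant (x , y)
  colourConstant-1⇒fullyInvariant {y} y∉S (b , y≈τbx) = fullyInvariant b≢0 y≋xb
    where
    y≋xb : y ≋ (1 , b)
    y≋xb = ≋-trans (⟪_⟫ {y} {τ b · pow x 1} y≈τbx) ⟪ refl , solve 2 (λ ξ b → :1 :* (ξ :* :1 :* :0 :+ :0) :+ b := b) refl ξ b ⟫
    b≢0 : b ≢ 0#
    b≢0 b≡0 = y∉S (1 , unwrap (≋-trans y≋xb (⟪_⟫ {1 , b} {1 , 0#} (refl , b≡0))))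

-- Necessity

invariant⇒conditions :
  ∀ {p d} → Prime p → 1 ≤ d → (F : FiniteField (p ^ d)) →
  ∀ {n ξ} → HasOrder F ξ n → 1 < n → MultOrder p n d →
  ∀ {y c} → Paley.ColourConstant F n ξ y c → c < n →
  Paley.FullyInvariant F n ξ (Paley.x F n ξ , y) → n ≡ 3 × p % 3 ≡ 2 × c ≡ 1
invariant⇒conditions {p} {d} p-prime 1≤d F {n} {ξ} ξ-order@(1≤n , ξⁿ≡1 , minimal) 1<n p-order
                     {c = c} (b , y≈τbxᶜ) c<n FI = n≡3 , p%3≡2 , c≡1
  where
  open FieldProperties F
  open PaleyGroup F n ξ 1≤n ξⁿ≡1
  open import Data.Nat as ℕ using (s≤s; z≤n)
  import Data.Nat.Properties as ℕP
  open import Data.Nat.Divisibility using (_∣_; m%n≡0⇒n∣m)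
  open import Data.Nat.DivMod using (m%n<n)
  open import Data.Nat.Primality using (prime⇒nonZero)
  open import Relation.Binary.PropositionalEquality
  open Arithmetic
  instance _ = prime⇒nonZero p-prime

  ξ^q≡ξ : ξ ^ᶠ (p ^ d) ≡ ξ
  ξ^q≡ξ = ξ^m≡ξ (ℕP.m^n>0 p d) (proj₁ (proj₂ p-order))

  open ColourEquations ξ^q≡ξ {c = c} ⟪ y≈τbxᶜ ⟫ (FI (plain D01)) (FI (plain D012))

  n≡3 : n ≡ 3
  n≡3 = order≡3 ξ-order 1<n ξ³≡1

  ξ¹≢1 : ξ ^ᶠ 1 ≢ 1#
  ξ¹≢1 = minimal 1 ℕP.≤-refl 1<n

  ξ²≢1 : ξ ^ᶠ 2 ≢ 1#
  ξ²≢1 = minimal 2 (s≤s z≤n) (subst (2 ℕ.<_) (sym n≡3) ℕP.≤-refl)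

  c≡1 : c ≡ 1
  c≡1 = <3∧≢0∧≢2⇒≡1 (subst (c ℕ.<_) n≡3 c<n) (c≢0 ξ²≢1) (c≢2 ξ¹≢1)

  p%3≢0 : p % 3 ≢ 0
  p%3≢0 p%3≡0 = 3≢1 (∣pᵈ∸1∧∣p⇒≡1 1≤d 3∣pᵈ-1 (m%n≡0⇒n∣m p 3 p%3≡0))
    where
    3∣pᵈ-1 : 3 ∣ p ^ d ℕ.∸ 1
    3∣pᵈ-1 = subst (_∣ p ^ d ℕ.∸ 1) n≡3 (proj₁ (proj₂ p-order))
    3≢1 : 3 ≢ 1
    3≢1 ()

  p%3≢1 : p % 3 ≢ 1
  p%3≢1 p%3≡1 = ξ²≢1 (mirror-over-prime-field p-prime (fromℕ-characteristic p d refl 1≤d) q≡p ξ^q≡ξ (FI (mirror idΩ)))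
    where
    n∣p¹-1 : n ∣ p ^ 1 ℕ.∸ 1
    n∣p¹-1 = subst₂ (λ m k → m ∣ k ℕ.∸ 1) (sym n≡3) (sym (ℕP.*-identityʳ p)) (%≡1⇒∣∸1 p 3 p%3≡1)
    q≡p : p ^ d ≡ p
    q≡p = trans (cong (p ^_) (ℕP.≤-antisym (multOrder-minimal p-order ℕP.≤-refl n∣p¹-1) 1≤d)) (ℕP.*-identityʳ p)

  p%3≡2 : p % 3 ≡ 2
  p%3≡2 = <3∧≢0∧≢1⇒≡2 (m%n<n p 3) p%3≢0 p%3≢1

corollary5p4 :
    (p d : ℕ) → Prime p → 1 ≤ d →
    (F : FiniteField (p ^ d)) →
    (n : ℕ) → AdmissibleValency p d n →
    (ξ : FiniteField.Carrier F) → HasOrder F ξ n →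
    (y : Paley.G F n ξ) → ¬ Paley.InS F n ξ y →
    (c : ℕ) → c < n → Paley.ColourConstant F n ξ y c →
    Paley.FullyInvariant F n ξ (Paley.x F n ξ , y)
      ⇔ (n ≡ 3 × p % 3 ≡ 2 × c ≡ 1)
corollary5p4 p d p-prime 1≤d F n admissible ξ ξ-order@(1≤n , ξⁿ≡1 , _) y y∉S c c<n y∈Txᶜ =
  mk⇔ (invariant⇒ admissible) invariant⇐
  where
  open Paley F n ξ
  open import Data.Sum using (inj₁; inj₂)
  open import Data.Empty using (⊥-elim)
  open import Function.Bundles using (mk⇔)
  open import Relation.Binary.PropositionalEquality using (refl)

  invariant⇒ : AdmissibleValency p d n → FullyInvariant (x , y) → n ≡ 3 × p % 3 ≡ 2 × c ≡ 1
  invariant⇒ (inj₁ (n≡1 , _)) FI =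
    ⊥-elim (y∉S (PaleyGroup.valency-1⇒y∈S F n ξ 1≤n ξⁿ≡1 n≡1 (FI (plain D01))))
  invariant⇒ (inj₂ (1<n , p-order)) = invariant⇒conditions p-prime 1≤d F ξ-order 1<n p-order y∈Txᶜ c<n

  invariant⇐ : n ≡ 3 × p % 3 ≡ 2 × c ≡ 1 → FullyInvariant (x , y)
  invariant⇐ (refl , p%3≡2 , refl) =
    ValencyThree.colourConstant-1⇒fullyInvariant F ξ-order p-prime
      (FieldProperties.fromℕ-characteristic F p d refl 1≤d) p%3≡2 y∉S y∈Txᶜ
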